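{- Let $p>2$ be a prime and $r\ge2$. Then $$\sum_{h\in(\mathbb{Z}/p\mathbb{Z})^{r-1}} a(h,p)\Delta(h,p)=(p+1)^r-p^r\sum_{\underline G}\lambda(\underline G)\,p^{ -\operatorname{codim}H_{\underline G}},$$ the sum on the right running over all set partitions $\underline G$ of $\{1,\dots,r\}$.
   Context: For $h\in(\mathbb{Z}/p\mathbb{Z})^{r-1}$ let $N_r(h,p)$ be the number of solutions $(y_1,\dots,y_r)$ in squares modulo $p$ (including $0$) of $y_i-y_{i+1}\equiv h_i\pmod p$, $1\le i\le r-1$; let $r_{eff}(h)$ be the number of distinct values among $y_1,\dots,y_r$ in any solution in $(\mathbb{Z}/p\mathbb{Z})^r$ of this system (independent of the solution); set $a(h,p)=2^{r_{eff}(h)}N_r(h,p)-p$ and $\Delta(h,p)=2^{r-r_{eff}(h)}$. For $i<j$ let $\sigma_{ij}(h)=\sum_{k=i}^{j-1}h_k$. A set partition $\underline F$ of $\{1,\dots,r\}$ is a collection of disjoint nonempty blocks with union $\{1,\dots,r\}$; $|\underline F|$ is the number of blocks. Set $H_{\underline F}=\{h\in(\mathbb{Z}/p\mathbb{Z})^{r-1}:\sigma_{ij}(h)=0 \text{ whenever } i<j \text{ lie in a common block of }\underline F\}$, a subspace of codimension $r-|\underline F|$; likewise $V_{\underline F}=\{v\in(\mathbb{Z}/p\mathbb{Z})^r: v_i=v_j \text{ whenever } i,j \text{ lie in a common block}\}$, of codimension $r-|\underline F|$ in $(\mathbb Z/p\mathbb Z)^r$. Partially order set partitions by $\underline F\preceq\underline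 G$ iff every block of $\underline F$ is contained in a block of $\underline G$, and let $\mu(\underline F,\underline G)$ be the Möbius function of this poset. Define $\lambda(\underline G)=\sum_{\underline F\preceq\underline G}\mu(\underline F,\underline G)\,2^{\operatorname{codim}V_{\underline F}}$. -}

module Defs where

open import Data.Nat as ℕ using (ℕ; zero; suc; _∸_)
import Data.Nat.Properties as ℕP
open import Data.Nat.Divisibility using (_∣?_)
open import Data.Integer as ℤ using (ℤ; +_; ∣_∣)
open import Data.Rational as ℚ using (ℚ)
open import Data.Fin using (Fin; toℕ)
open import Data.Vec as V using (Vec; []; _∷_)
open import Data.List as L using (List; []; _∷_; map; concatMap; filterᵇ; length; allFin; upTo; foldr)
open import Data.Bool using (Bool; true; false; _∧_; _∨_; not; if_then_else_)
open import Relation.Nullary.Decidable using (⌊_⌋)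
open import Data.Bool.ListAction using (any; all)

-- Arithmetic in Z/pZ.  Residues are represented by Fin p (the
-- representatives 0,…,p-1); congruences are tested in ℤ.

congᵇ : ℕ → ℤ → ℤ → Bool
congᵇ p a b = ⌊ p ∣? ∣ a ℤ.- b ∣ ⌋

res : ∀ {p} → Fin p → ℤ
res x = + toℕ x

allVec : (p n : ℕ) → List (Vec (Fin p) n)
allVec p zero    = [] ∷ []
allVec p (suc n) = concatMap (λ x → map (x ∷_) (allVec p n)) (allFin p)

-- y is a square modulo p (0 included)
isSquare : ∀ {p} → Fin p → Bool
isSquare {p} y = any (λ x → congᵇ p (res x ℤ.* res x) (res y)) (allFin p)

allSquares : ∀ {p n} → Vec (Fin p) n → Bool
allSquares []       = true
allSquares (y ∷ ys) = isSquare y ∧ allSquares ys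

solves′ : ∀ {p n} → Vec (Fin p) (suc n) → Vec (Fin p) n → Bool
solves′ (y ∷ [])           []       = true
solves′ {p} (y₁ ∷ y₂ ∷ ys) (h ∷ hs) =
  congᵇ p (res y₁ ℤ.- res y₂) (res h) ∧ solves′ (y₂ ∷ ys) hs

solves : ∀ {p} (r : ℕ) → Vec (Fin p) r → Vec (Fin p) (r ∸ 1) → Bool
solves zero    []  []  = true
solves (suc n) y   h   = solves′ y h

N : (p r : ℕ) → Vec (Fin p) (r ∸ 1) → ℕ
N p r h = length (filterᵇ (λ y → allSquares y ∧ solves r y h) (allVec p r))

-- r_eff(h): number of distinct values (mod p) among the entries of a
-- solution in (Z/pZ)^r.  We use the solution y_i = σ_{i r}(h) = h_i+…+h_{r-1},
-- y_r = 0 (any solution gives the same number).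

canon : ∀ {p n} → Vec (Fin p) n → Vec ℤ (suc n)
canon []       = + 0 ∷ []
canon (h ∷ hs) = let c = canon hs in (res h ℤ.+ V.head c) ∷ c

distinctMod : ℕ → List ℤ → ℕ
distinctMod p []       = 0
distinctMod p (x ∷ xs) =
  (if any (congᵇ p x) xs then 0 else 1) ℕ.+ distinctMod p xs

reff : (p r : ℕ) → Vec (Fin p) (r ∸ 1) → ℕ
reff p zero    h = 0
reff p (suc n) h = distinctMod p (V.toList (canon h))

a : (p r : ℕ) → Vec (Fin p) (r ∸ 1) → ℤ
a p r h = + (2 ℕ.^ reff p r h ℕ.* N p r h) ℤ.- + p

Δ : (p r : ℕ) → Vec (Fin p) (r ∸ 1) → ℕ
Δ p r h = 2 ℕ.^ (r ∸ reff p r h)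

sumℤ : List ℤ → ℤ
sumℤ = foldr ℤ._+_ (+ 0)

sumℚ : List ℚ → ℚ
sumℚ = foldr ℚ._+_ ℚ.0ℚ

lhs : (p r : ℕ) → ℤ
lhs p r = sumℤ (map (λ h → a p r h ℤ.* + Δ p r h) (allVec p (r ∸ 1)))

-- Set partitions of {1,…,r}, encoded canonically as restricted growth
-- strings G : Vec ℕ r (i and j lie in a common block iff G_i = G_j;
-- G_1 = 0 and each G_i is at most 1 + max of the previous labels).

SetPartition : ℕ → Set
SetPartition r = Vec ℕ r

-- restricted growth strings of length k, given that labels 0..m-1 are used
rgsFrom : (k m : ℕ) → List (Vec ℕ k)
rgsFrom zero    m = [] ∷ []
rgsFrom (suc k) m =
  concatMap (λ l → map (l ∷_) (rgsFrom k (if l ℕ.≡ᵇ m then suc m else m)))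
            (upTo (suc m))

setPartitions : (r : ℕ) → List (SetPartition r)
setPartitions r = rgsFrom r 0

sameBlock : ∀ {r} → SetPartition r → Fin r → Fin r → Bool
sameBlock G i j = V.lookup G i ℕ.≡ᵇ V.lookup G j

_≼ᵇ_ : ∀ {r} → SetPartition r → SetPartition r → Bool
_≼ᵇ_ {r} F G =
  all (λ i → all (λ j → not (sameBlock F i j) ∨ sameBlock G i j) (allFin r)) (allFin r)

_=ᵇ_ : ∀ {r} → SetPartition r → SetPartition r → Bool
F =ᵇ G = (F ≼ᵇ G) ∧ (G ≼ᵇ F)

distinctℕ : List ℕ → ℕ
distinctℕ []       = 0
distinctℕ (x ∷ xs) = (if any (x ℕ.≡ᵇ_) xs then 0 else 1) ℕ.+ distinctℕ xs

numBlocks : ∀ {r} → SetPartition r → ℕ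
numBlocks G = distinctℕ (V.toList G)

-- codimensions of H_F ⊆ (Z/pZ)^{r-1} and V_F ⊆ (Z/pZ)^r (both r - |F|)
codimH : ∀ {r} → SetPartition r → ℕ
codimH {r} F = r ∸ numBlocks F

codimV : ∀ {r} → SetPartition r → ℕ
codimV {r} F = r ∸ numBlocks F

-- The fuel `length elems` bounds the length
-- of every chain, so the recursion is never cut short.

module Mobius {A : Set} (elems : List A) (_≤ᵇ_ _≐ᵇ_ : A → A → Bool) where
  μfuel : ℕ → A → A → ℤ
  μfuel zero    x y = + 0
  μfuel (suc n) x y =
    if x ≐ᵇ y then + 1
    else if x ≤ᵇ y
      then ℤ.- sumℤ (map (μfuel n x)
                (filterᵇ (λ z → (x ≤ᵇ z) ∧ (z ≤ᵇ y) ∧ not (z ≐ᵇ y)) elems))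
      else + 0

  μ : A → A → ℤ
  μ = μfuel (length elems)

μP : (r : ℕ) → SetPartition r → SetPartition r → ℤ
μP r = Mobius.μ (setPartitions r) _≼ᵇ_ _=ᵇ_

λP : (r : ℕ) → SetPartition r → ℤ
λP r G = sumℤ (map (λ F → μP r F G ℤ.* + (2 ℕ.^ codimV F))
                   (filterᵇ (λ F → F ≼ᵇ G) (setPartitions r)))

ℤ→ℚ : ℤ → ℚ
ℤ→ℚ z = z ℚ./ 1

-- p^{-k} (p ≠ 0; value 0 for p = 0, never used)
invPow : ℕ → ℕ → ℚ
invPow zero    k = ℚ.0ℚ
invPow (suc q) k = ℚ._/_ (+ 1) (suc q ℕ.^ k) {{ℕP.m^n≢0 (suc q) k}}

rhs : (p r : ℕ) → ℚ
rhs p r = ℤ→ℚ (+ ((p ℕ.+ 1) ℕ.^ r))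
  ℚ.- ℤ→ℚ (+ (p ℕ.^ r))
      ℚ.* sumℚ (map (λ G → ℤ→ℚ (λP r G) ℚ.* invPow p (codimH G)) (setPartitions r))

module Submission where

-- Since a(h,p)Δ(h,p) = 2^r N_r(h,p) - p 2^(r - r_eff(h)), both sums on the left can be taken over
-- y ∈ (ℤ/pℤ)^r instead of h: every y solves the system for exactly one h, every h has exactly p
-- solutions, and r_eff(h) is the number of blocks of the kernel of any of them. The first sum then
-- counts r-tuples of squares, giving ((p+1)/2)^r 2^r = (p+1)^r; the second is Σ_y 2^(codim V_ker(y)).
-- On the right, p^r p^(-codim H_G) = p^|G| is the number of y constant on the blocks of G, so
-- Σ_G λ(G) p^|G| = Σ_y Σ_{G ≼ ker y} λ(G), which is Σ_y 2^(codim V_ker(y)) by Möbius inversion.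
-- Set partitions are restricted growth strings, and every kernel is represented by exactly one.

open import Defs
open import Algebra.Bundles using (CommutativeRing)
open import Data.Bool using (Bool; true; false; _∧_; _∨_; not; if_then_else_)
import Data.Bool.Properties as BoolP
open import Data.Bool.ListAction using (any; all)
open import Data.Empty using (⊥; ⊥-elim)
open import Data.Fin as Fin using (Fin; toℕ; fromℕ<)
import Data.Fin.Properties as FinP
open import Data.Integer as ℤ using (ℤ; +_; ∣_∣)
import Data.Integer.Divisibility.Signed as ℤ∣
open import Data.Integer.DivMod using (_%ℕ_; _/ℕ_; n%ℕd<d; a≡a%ℕn+[a/ℕn]*n)
import Data.Integer.Properties as ℤP
open import Data.Integer.Tactic.RingSolver using (solve-∀)
open import Data.List as List using (List; []; _∷_; _++_; [_]; map; concatMap; filterᵇ; length; allFin; upTo)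
open import Data.List.Membership.Propositional using (_∈_; find)
open import Data.List.Membership.Propositional.Properties
  using (∈-allFin; ∈-upTo⁻; ∈-filter⁻; ∈-length; ∈-map⁻; ∈-concatMap⁻)
import Data.List.Properties as ListP
open import Data.List.Relation.Unary.Any using (here; there)
open import Data.Maybe using (Maybe; just; nothing)
import Data.Maybe as Maybe
import Data.Maybe.Properties as MaybeP
open import Data.Nat as ℕ using (ℕ; zero; suc; _≤_; _<_; z≤n; s≤s; _∸_; _^_)
import Data.Nat.Divisibility as ℕDiv
open import Data.Nat.Primality using (Prime; euclidsLemma)
import Data.Nat.Properties as ℕP
import Data.Nat.Tactic.RingSolver as ℕSolver
open import Data.Product using (∃; _×_; _,_; proj₁; proj₂)
open import Data.Rational as ℚ using (ℚ)
import Data.Rational.Properties as ℚP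
import Data.Rational.Unnormalised as ℚᵘ
import Data.Rational.Unnormalised.Properties as ℚᵘP
open import Data.Sum as Sum using (_⊎_; inj₁; inj₂; [_,_]′)
open import Data.Vec as Vec using (Vec; []; _∷_; toList)
import Data.Vec.Properties as VecP
open import Function using (_∘_; id; Equivalence)
open import Relation.Binary.Definitions using (tri<; tri≈; tri>)
open import Relation.Binary.PropositionalEquality hiding ([_])
open import Relation.Nullary using (¬_; Dec; does; yes; no)
open import Relation.Nullary.Decidable using (T?; ⌊_⌋)

open import Algebra.Properties.CommutativeSemigroup
  (CommutativeRing.*-commutativeSemigroup ℚP.+-*-commutativeRing) using (interchange)

∧-elim : ∀ {a b} → a ∧ b ≡ true → a ≡ true × b ≡ true
∧-elim {true} {true} refl = refl , refl

∧-intro : ∀ {a b} → a ≡ true → b ≡ true → a ∧ b ≡ true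
∧-intro refl refl = refl

true≢false : true ≡ false → ⊥
true≢false ()

Bool-ext : ∀ {a b} → (a ≡ true → b ≡ true) → (b ≡ true → a ≡ true) → a ≡ b
Bool-ext {true}  {true}  _ _ = refl
Bool-ext {true}  {false} f _ = sym (f refl)
Bool-ext {false} {true}  _ g = g refl
Bool-ext {false} {false} _ _ = refl

∨-true⁻ : ∀ {a b} → a ∨ b ≡ true → a ≡ true ⊎ b ≡ true
∨-true⁻ {true}  _ = inj₁ refl
∨-true⁻ {false} b = inj₂ b

≡ᵇ-refl : ∀ n → (n ℕ.≡ᵇ n) ≡ true
≡ᵇ-refl n = Equivalence.to BoolP.T-≡ (ℕP.≡⇒≡ᵇ n n refl)

≡ᵇ⇒≡ : ∀ {m n} → (m ℕ.≡ᵇ n) ≡ true → m ≡ n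
≡ᵇ⇒≡ {m} {n} m≡ᵇn = ℕP.≡ᵇ⇒≡ m n (Equivalence.from BoolP.T-≡ m≡ᵇn)

≢⇒≡ᵇ-false : ∀ {m n} → ¬ m ≡ n → (m ℕ.≡ᵇ n) ≡ false
≢⇒≡ᵇ-false {m} {n} m≢n with m ℕ.≡ᵇ n in m≡ᵇn
... | true  = ⊥-elim (m≢n (≡ᵇ⇒≡ m≡ᵇn))
... | false = refl

module _ {A : Set} where

  filter-length-mono : (xs : List A) (b b′ : A → Bool) → (∀ w → b w ≡ true → b′ w ≡ true) →
                       length (filterᵇ b xs) ≤ length (filterᵇ b′ xs)
  filter-length-mono []       b b′ b⇒b′ = z≤n
  filter-length-mono (x ∷ xs) b b′ b⇒b′ with b x in bx | b′ x in b′x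
  ... | true  | true  = s≤s (filter-length-mono xs b b′ b⇒b′)
  ... | true  | false = ⊥-elim (true≢false (trans (sym (b⇒b′ x bx)) b′x))
  ... | false | true  = ℕP.m≤n⇒m≤1+n (filter-length-mono xs b b′ b⇒b′)
  ... | false | false = filter-length-mono xs b b′ b⇒b′

  filter-length-strict : (xs : List A) (b b′ : A → Bool) → (∀ w → b w ≡ true → b′ w ≡ true) →
                         ∀ {w} → w ∈ xs → b w ≡ false → b′ w ≡ true →
                         length (filterᵇ b xs) < length (filterᵇ b′ xs)
  filter-length-strict (x ∷ xs) b b′ b⇒b′ (here refl) bw b′w rewrite bw | b′w =
    s≤s (filter-length-mono xs b b′ b⇒b′)
  filter-length-strict (x ∷ xs) b b′ b⇒b′ (there w∈xs) bw b′w with b x in bx | b′ x in b′x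
  ... | true  | true  = s≤s (filter-length-strict xs b b′ b⇒b′ w∈xs bw b′w)
  ... | true  | false = ⊥-elim (true≢false (trans (sym (b⇒b′ x bx)) b′x))
  ... | false | true  = ℕP.m≤n⇒m≤1+n (filter-length-strict xs b b′ b⇒b′ w∈xs bw b′w)
  ... | false | false = filter-length-strict xs b b′ b⇒b′ w∈xs bw b′w

  filter-cong : (xs : List A) {b b′ : A → Bool} → (∀ x → b x ≡ b′ x) → filterᵇ b xs ≡ filterᵇ b′ xs
  filter-cong []       b≗b′ = refl
  filter-cong (x ∷ xs) {b} {b′} b≗b′ rewrite b≗b′ x with b′ x
  ... | true  = cong (x ∷_) (filter-cong xs b≗b′)
  ... | false = filter-cong xs b≗b′

  ∈-filterᵇ⁻ : (b : A → Bool) {xs : List A} {z : A} → z ∈ filterᵇ b xs → z ∈ xs × b z ≡ true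
  ∈-filterᵇ⁻ b z∈ = let z∈xs , bz = ∈-filter⁻ (T? ∘ b) z∈ in z∈xs , Equivalence.to BoolP.T-≡ bz

module _ {A : Set} (f : A → Bool) where

  any-++ : ∀ xs ys → any f (xs ++ ys) ≡ any f xs ∨ any f ys
  any-++ []       ys = refl
  any-++ (x ∷ xs) ys rewrite any-++ xs ys = sym (BoolP.∨-assoc (f x) (any f xs) (any f ys))

  any-true⁺ : ∀ {xs x} → x ∈ xs → f x ≡ true → any f xs ≡ true
  any-true⁺ {y ∷ xs} (here refl) fx rewrite fx = refl
  any-true⁺ {y ∷ xs} (there x∈) fx rewrite any-true⁺ x∈ fx = BoolP.∨-zeroʳ (f y)

  any-true⁻ : ∀ xs → any f xs ≡ true → ∃ λ x → f x ≡ true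
  any-true⁻ (y ∷ xs) any≡t with f y in fy
  ... | true  = y , fy
  ... | false = any-true⁻ xs any≡t

  any-false⁻ : ∀ {xs x} → any f xs ≡ false → x ∈ xs → f x ≡ false
  any-false⁻ {x = x} any≡f x∈ with f x in fx
  ... | true  = ⊥-elim (true≢false (trans (sym (any-true⁺ x∈ fx)) any≡f))
  ... | false = refl

  all-true⁻ : ∀ {xs} → all f xs ≡ true → ∀ {x} → x ∈ xs → f x ≡ true
  all-true⁻ {y ∷ xs} all≡t (here refl) = proj₁ (∧-elim {f y} all≡t)
  all-true⁻ {y ∷ xs} all≡t (there x∈) = all-true⁻ (proj₂ (∧-elim {f y} all≡t)) x∈

  all-true⁺ : ∀ xs → (∀ {x} → x ∈ xs → f x ≡ true) → all f xs ≡ true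
  all-true⁺ []       _   = refl
  all-true⁺ (y ∷ xs) all = ∧-intro (all (here refl)) (all-true⁺ xs (all ∘ there))

infixr 8 ⟦_⟧_

⟦_⟧_ : Bool → ℤ → ℤ
⟦ b ⟧ z = if b then z else + 0

∑ : {A : Set} → List A → (A → ℤ) → ℤ
∑ xs f = sumℤ (map f xs)

infixr 5 ∑
syntax ∑ xs (λ x → e) = ∑[ x ← xs ] e

⟦⟧-false : ∀ {b} z → b ≡ false → ⟦ b ⟧ z ≡ + 0
⟦⟧-false z refl = refl

⟦⟧-∧ : ∀ a b z → ⟦ a ∧ b ⟧ z ≡ ⟦ a ⟧ ⟦ b ⟧ z
⟦⟧-∧ true  b z = refl
⟦⟧-∧ false b z = refl

⟦⟧-comm : ∀ a b z → ⟦ a ⟧ ⟦ b ⟧ z ≡ ⟦ b ⟧ ⟦ a ⟧ z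
⟦⟧-comm true  true  z = refl
⟦⟧-comm true  false z = refl
⟦⟧-comm false true  z = refl
⟦⟧-comm false false z = refl

⟦⟧-∧-absurd : ∀ a b z → (a ≡ true → b ≡ true → ⊥) → ⟦ a ∧ b ⟧ z ≡ + 0
⟦⟧-∧-absurd true  true  z ¬a∧b = ⊥-elim (¬a∧b refl refl)
⟦⟧-∧-absurd true  false z ¬a∧b = refl
⟦⟧-∧-absurd false b     z ¬a∧b = refl

⟦⟧-*-one : ∀ b z → z ℤ.* ⟦ b ⟧ + 1 ≡ ⟦ b ⟧ z
⟦⟧-*-one true  z = ℤP.*-identityʳ z
⟦⟧-*-one false z = ℤP.*-zeroʳ z

⟦⟧-∨ : ∀ a b z → (a ≡ true → b ≡ false) → ⟦ a ∨ b ⟧ z ≡ ⟦ a ⟧ z ℤ.+ ⟦ b ⟧ z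
⟦⟧-∨ true  true  z exclusive with () ← exclusive refl
⟦⟧-∨ true  false z _ = sym (ℤP.+-identityʳ z)
⟦⟧-∨ false b     z _ = sym (ℤP.+-identityˡ _)

module _ {A : Set} where

  ∑-++ : (xs ys : List A) (f : A → ℤ) → ∑ (xs ++ ys) f ≡ ∑ xs f ℤ.+ ∑ ys f
  ∑-++ []       ys f = sym (ℤP.+-identityˡ _)
  ∑-++ (x ∷ xs) ys f = trans (cong (ℤ._+_ (f x)) (∑-++ xs ys f)) (sym (ℤP.+-assoc (f x) _ _))

  ∑-cong-∈ : (xs : List A) {f g : A → ℤ} → (∀ {x} → x ∈ xs → f x ≡ g x) → ∑ xs f ≡ ∑ xs g
  ∑-cong-∈ []       eq = refl
  ∑-cong-∈ (x ∷ xs) eq = cong₂ ℤ._+_ (eq (here refl)) (∑-cong-∈ xs (eq ∘ there))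

  ∑-cong : (xs : List A) {f g : A → ℤ} → (∀ x → f x ≡ g x) → ∑ xs f ≡ ∑ xs g
  ∑-cong xs eq = ∑-cong-∈ xs (λ {x} _ → eq x)

  ∑-zero : (xs : List A) → ∑[ _ ← xs ] + 0 ≡ + 0
  ∑-zero []       = refl
  ∑-zero (x ∷ xs) = trans (ℤP.+-identityˡ _) (∑-zero xs)

  ∑-vanishes : (xs : List A) {f : A → ℤ} → (∀ x → f x ≡ + 0) → ∑ xs f ≡ + 0
  ∑-vanishes xs f≡0 = trans (∑-cong xs f≡0) (∑-zero xs)

  ∑-+ : (xs : List A) (f g : A → ℤ) → ∑[ x ← xs ] (f x ℤ.+ g x) ≡ ∑ xs f ℤ.+ ∑ xs g
  ∑-+ []       f g = refl
  ∑-+ (x ∷ xs) f g = trans (cong (ℤ._+_ (f x ℤ.+ g x)) (∑-+ xs f g)) (medial (f x) (g x) _ _)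
    where
    medial : ∀ a b c d → (a ℤ.+ b) ℤ.+ (c ℤ.+ d) ≡ (a ℤ.+ c) ℤ.+ (b ℤ.+ d)
    medial = solve-∀

  ∑-minus : (xs : List A) (f g : A → ℤ) → ∑[ x ← xs ] (f x ℤ.- g x) ≡ ∑ xs f ℤ.- ∑ xs g
  ∑-minus []       f g = refl
  ∑-minus (x ∷ xs) f g = trans (cong (ℤ._+_ (f x ℤ.- g x)) (∑-minus xs f g)) (medial (f x) (g x) _ _)
    where
    medial : ∀ a b c d → (a ℤ.- b) ℤ.+ (c ℤ.- d) ≡ (a ℤ.+ c) ℤ.- (b ℤ.+ d)
    medial = solve-∀

  ∑-*ˡ : (xs : List A) (c : ℤ) (f : A → ℤ) → ∑[ x ← xs ] (c ℤ.* f x) ≡ c ℤ.* ∑ xs f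
  ∑-*ˡ []       c f = sym (ℤP.*-zeroʳ c)
  ∑-*ˡ (x ∷ xs) c f = trans (cong (ℤ._+_ (c ℤ.* f x)) (∑-*ˡ xs c f)) (sym (ℤP.*-distribˡ-+ c (f x) _))

  ∑-const : (xs : List A) (c : ℤ) → ∑[ _ ← xs ] c ≡ c ℤ.* + length xs
  ∑-const []       c = sym (ℤP.*-zeroʳ c)
  ∑-const (x ∷ xs) c = trans (cong (ℤ._+_ c) (∑-const xs c)) (step c (length xs))
    where
    step : ∀ c n → c ℤ.+ c ℤ.* + n ≡ c ℤ.* + suc n
    step c n = trans (distrib c (+ n)) (cong (c ℤ.*_) (sym (ℤP.pos-+ 1 n)))
      where
      distrib : ∀ c m → c ℤ.+ c ℤ.* m ≡ c ℤ.* (+ 1 ℤ.+ m)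
      distrib = solve-∀

  ∑-⟦⟧ : (b : Bool) (xs : List A) (f : A → ℤ) → ⟦ b ⟧ ∑ xs f ≡ ∑[ x ← xs ] ⟦ b ⟧ f x
  ∑-⟦⟧ true  xs f = refl
  ∑-⟦⟧ false xs f = sym (∑-zero xs)

  ∑-filter : (xs : List A) (b : A → Bool) (f : A → ℤ) → ∑ (filterᵇ b xs) f ≡ ∑[ x ← xs ] ⟦ b x ⟧ f x
  ∑-filter []       b f = refl
  ∑-filter (x ∷ xs) b f with b x
  ... | true  = cong (ℤ._+_ (f x)) (∑-filter xs b f)
  ... | false = trans (∑-filter xs b f) (sym (ℤP.+-identityˡ _))

  length-filter : (xs : List A) (b : A → Bool) → + length (filterᵇ b xs) ≡ ∑[ x ← xs ] ⟦ b x ⟧ + 1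
  length-filter []       b = refl
  length-filter (x ∷ xs) b with b x
  ... | true  = trans (ℤP.pos-+ 1 (length (filterᵇ b xs))) (cong (ℤ._+_ (+ 1)) (length-filter xs b))
  ... | false = trans (length-filter xs b) (sym (ℤP.+-identityˡ _))

  ∑-nonzero : (xs : List A) (f : A → ℤ) → ¬ ∑ xs f ≡ + 0 → ∃ λ x → x ∈ xs × ¬ f x ≡ + 0
  ∑-nonzero []       f ∑≢0 = ⊥-elim (∑≢0 refl)
  ∑-nonzero (x ∷ xs) f ∑≢0 with f x ℤ.≟ + 0
  ... | no  fx≢0 = x , here refl , fx≢0
  ... | yes fx≡0 =
    let y , y∈xs , fy≢0 = ∑-nonzero xs f (λ ∑≡0 → ∑≢0 (cong₂ ℤ._+_ fx≡0 ∑≡0))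
    in  y , there y∈xs , fy≢0

module _ {A B : Set} where

  ∑-map : (xs : List A) (g : A → B) (f : B → ℤ) → ∑ (map g xs) f ≡ ∑ xs (f ∘ g)
  ∑-map []       g f = refl
  ∑-map (x ∷ xs) g f = cong (ℤ._+_ (f (g x))) (∑-map xs g f)

  ∑-concatMap : (xs : List A) (g : A → List B) (f : B → ℤ) →
                ∑ (concatMap g xs) f ≡ ∑[ x ← xs ] ∑ (g x) f
  ∑-concatMap []       g f = refl
  ∑-concatMap (x ∷ xs) g f =
    trans (∑-++ (g x) (concatMap g xs) f) (cong (ℤ._+_ (∑ (g x) f)) (∑-concatMap xs g f))

  ∑-comm : (xs : List A) (ys : List B) (f : A → B → ℤ) →
           ∑[ x ← xs ] ∑[ y ← ys ] f x y ≡ ∑[ y ← ys ] ∑[ x ← xs ] f x y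
  ∑-comm []       ys f = sym (∑-zero ys)
  ∑-comm (x ∷ xs) ys f =
    trans (cong (ℤ._+_ (∑ ys (f x))) (∑-comm xs ys f)) (sym (∑-+ ys (f x) (λ y → ∑[ x′ ← xs ] f x′ y)))

∑-allFin-suc : ∀ n (f : Fin (suc n) → ℤ) → ∑ (allFin (suc n)) f ≡ f Fin.zero ℤ.+ ∑ (allFin n) (f ∘ Fin.suc)
∑-allFin-suc n f = cong (ℤ._+_ (f Fin.zero))
  (trans (cong (λ xs → ∑ xs f) (sym (ListP.map-tabulate id Fin.suc))) (∑-map (allFin n) Fin.suc f))

∑-allFin-δ : ∀ n (d : Fin n) (c : ℤ) → ∑[ x ← allFin n ] ⟦ does (x FinP.≟ d) ⟧ c ≡ c
∑-allFin-δ (suc n) Fin.zero    c = trans (∑-allFin-suc n (λ x → ⟦ does (x FinP.≟ Fin.zero) ⟧ c))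
  (trans (cong (ℤ._+_ c) (∑-zero (allFin n))) (ℤP.+-identityʳ c))
∑-allFin-δ (suc n) (Fin.suc d) c = trans (∑-allFin-suc n (λ x → ⟦ does (x FinP.≟ Fin.suc d) ⟧ c))
  (trans (ℤP.+-identityˡ _) (∑-allFin-δ n d c))

∑-allFin-const : ∀ n (c : ℤ) → ∑[ _ ← allFin n ] c ≡ c ℤ.* + n
∑-allFin-const n c = trans (∑-const (allFin n) c) (cong (λ k → c ℤ.* + k) (ListP.length-tabulate id))

∑-allVec-suc : ∀ p k (f : Vec (Fin p) (suc k) → ℤ) →
               ∑ (allVec p (suc k)) f ≡ ∑[ x ← allFin p ] ∑[ y ← allVec p k ] f (x ∷ y)
∑-allVec-suc p k f = trans (∑-concatMap (allFin p) (λ x → map (x ∷_) (allVec p k)) f)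
                           (∑-cong (allFin p) (λ x → ∑-map (allVec p k) (x ∷_) f))

∑-allFin-unique : ∀ {n} (g : Fin n → Bool) (x₀ : Fin n) → (∀ x → g x ≡ true → x ≡ x₀) → g x₀ ≡ true →
                  ∀ c → ∑[ x ← allFin n ] ⟦ g x ⟧ c ≡ c
∑-allFin-unique {n} g x₀ only g₀ c = trans (∑-cong (allFin n) at) (∑-allFin-δ n x₀ c)
  where
  at : ∀ x → ⟦ g x ⟧ c ≡ ⟦ does (x FinP.≟ x₀) ⟧ c
  at x with g x in gx | x FinP.≟ x₀
  ... | true  | yes _   = refl
  ... | true  | no x≢x₀ = ⊥-elim (x≢x₀ (only x gx))
  ... | false | yes refl = ⊥-elim (true≢false (trans (sym g₀) gx))
  ... | false | no _    = refl

-- Möbius inversion on a finite preorder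

module MobiusInversion {A : Set} (P : List A) (_≤ᵇ_ : A → A → Bool)
  (≤-refl : ∀ x → (x ≤ᵇ x) ≡ true)
  (≤-trans : ∀ {x y z} → (x ≤ᵇ y) ≡ true → (y ≤ᵇ z) ≡ true → (x ≤ᵇ z) ≡ true)
  where

  _≈ᵇ_ : A → A → Bool
  x ≈ᵇ y = (x ≤ᵇ y) ∧ (y ≤ᵇ x)

  _∈[_,_⟩ : A → A → A → Bool
  z ∈[ x , y ⟩ = (x ≤ᵇ z) ∧ (z ≤ᵇ y) ∧ not (z ≈ᵇ y)

  open Mobius P _≤ᵇ_ _≈ᵇ_ public

  ≈-sym : ∀ {x y} → (x ≈ᵇ y) ≡ true → (y ≈ᵇ x) ≡ true
  ≈-sym {x} {y} x≈y = let x≤y , y≤x = ∧-elim {x ≤ᵇ y} x≈y in ∧-intro y≤x x≤y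

  ≈-trans : ∀ {x y z} → (x ≈ᵇ y) ≡ true → (y ≈ᵇ z) ≡ true → (x ≈ᵇ z) ≡ true
  ≈-trans {x} {y} {z} x≈y y≈z =
    let x≤y , y≤x = ∧-elim {x ≤ᵇ y} x≈y ; y≤z , z≤y = ∧-elim {y ≤ᵇ z} y≈z
    in  ∧-intro (≤-trans x≤y y≤z) (≤-trans z≤y y≤x)

  ≤-respʳ-≈ : ∀ {y y′} z → (y ≈ᵇ y′) ≡ true → (z ≤ᵇ y) ≡ (z ≤ᵇ y′)
  ≤-respʳ-≈ {y} z y≈y′ = let y≤y′ , y′≤y = ∧-elim {y ≤ᵇ _} y≈y′ in
    Bool-ext (λ z≤y → ≤-trans z≤y y≤y′) (λ z≤y′ → ≤-trans z≤y′ y′≤y)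

  ≤-respˡ-≈ : ∀ {y y′} z → (y ≈ᵇ y′) ≡ true → (y ≤ᵇ z) ≡ (y′ ≤ᵇ z)
  ≤-respˡ-≈ {y} z y≈y′ = let y≤y′ , y′≤y = ∧-elim {y ≤ᵇ _} y≈y′ in
    Bool-ext (λ y≤z → ≤-trans y′≤y y≤z) (λ y′≤z → ≤-trans y≤y′ y′≤z)

  ≈-respʳ-≈ : ∀ {y y′} z → (y ≈ᵇ y′) ≡ true → (z ≈ᵇ y) ≡ (z ≈ᵇ y′)
  ≈-respʳ-≈ z y≈y′ = cong₂ _∧_ (≤-respʳ-≈ z y≈y′) (≤-respˡ-≈ z y≈y′)

  μfuel-respʳ-≈ : ∀ n x {y y′} → (y ≈ᵇ y′) ≡ true → μfuel n x y ≡ μfuel n x y′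
  μfuel-respʳ-≈ zero    x y≈y′ = refl
  μfuel-respʳ-≈ (suc n) x {y} {y′} y≈y′
    rewrite ≈-respʳ-≈ x y≈y′ | ≤-respʳ-≈ x y≈y′
          | filter-cong P {λ z → z ∈[ x , y ⟩} {λ z → z ∈[ x , y′ ⟩}
              (λ z → cong₂ (λ u v → (x ≤ᵇ z) ∧ u ∧ not v) (≤-respʳ-≈ z y≈y′) (≈-respʳ-≈ z y≈y′))
          = refl

  intervalSize : A → A → ℕ
  intervalSize x y = length (filterᵇ (λ w → (x ≤ᵇ w) ∧ (w ≤ᵇ y)) P)

  intervalSize-pos : ∀ {x y} → (x ≤ᵇ y) ≡ true → y ∈ P → 0 < intervalSize x y
  intervalSize-pos x≤y y∈P = ℕP.≤-<-trans z≤n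
    (filter-length-strict P (λ _ → false) _ (λ _ ()) y∈P refl (∧-intro x≤y (≤-refl _)))

  intervalSize-shrinks : ∀ {x y z} → (x ≤ᵇ y) ≡ true → y ∈ P → (z ∈[ x , y ⟩) ≡ true →
                         intervalSize x z < intervalSize x y
  intervalSize-shrinks {x} {y} {z} x≤y y∈P z∈[x,y⟩ =
    let x≤z , z≤y∧z≉y = ∧-elim {x ≤ᵇ z} z∈[x,y⟩
        z≤y , z≉y     = ∧-elim {z ≤ᵇ y} z≤y∧z≉y
    in  filter-length-strict P _ _
          (λ w x≤w∧w≤z → let x≤w , w≤z = ∧-elim {x ≤ᵇ w} x≤w∧w≤z in ∧-intro x≤w (≤-trans w≤z z≤y))
          y∈P (y≰z (y ≤ᵇ z) z≤y z≉y) (∧-intro x≤y (≤-refl y))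
    where
    y≰z : ∀ b → (z ≤ᵇ y) ≡ true → not ((z ≤ᵇ y) ∧ b) ≡ true → (x ≤ᵇ y) ∧ b ≡ false
    y≰z false _ _ rewrite x≤y = refl
    y≰z true  z≤y z≉y rewrite z≤y with () ← z≉y

  μfuel-stable : ∀ n x y → y ∈ P → intervalSize x y ≤ n → μfuel n x y ≡ μfuel (suc n) x y
  μfuel-stable zero x y y∈P size≤0 with x ≤ᵇ y in x≤y
  ... | true  = ⊥-elim (ℕP.<⇒≱ (intervalSize-pos x≤y y∈P) size≤0)
  ... | false = refl
  μfuel-stable (suc n) x y y∈P size≤1+n with x ≈ᵇ y
  ... | true  = refl
  ... | false with x ≤ᵇ y in x≤y
  ...   | false = refl
  ...   | true  = cong ℤ.-_ (∑-cong-∈ (filterᵇ (λ z → z ∈[ x , y ⟩) P) stable)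
    where
    stable : ∀ {z} → z ∈ filterᵇ (λ z → z ∈[ x , y ⟩) P → μfuel n x z ≡ μfuel (suc n) x z
    stable z∈ = let z∈P , z∈[x,y⟩ = ∈-filterᵇ⁻ (λ z → z ∈[ x , y ⟩) z∈ in
      μfuel-stable n x _ z∈P (ℕP.≤-pred (ℕP.≤-trans (intervalSize-shrinks x≤y y∈P z∈[x,y⟩) size≤1+n))

  μ-unfold : ∀ {F K} → K ∈ P → (F ≈ᵇ K) ≡ false → (F ≤ᵇ K) ≡ true →
             μ F K ≡ ℤ.- ∑ (filterᵇ (λ z → z ∈[ F , K ⟩) P) (μ F)
  μ-unfold {F} {K} K∈P F≉K F≤K with length P in |P|≡
  ... | zero  = ⊥-elim (ℕP.<-irrefl (sym |P|≡) (∈-length K∈P))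
  ... | suc n rewrite F≉K | F≤K = cong ℤ.-_ (∑-cong-∈ (filterᵇ (λ z → z ∈[ F , K ⟩) P) stable)
    where
    stable : ∀ {z} → z ∈ filterᵇ (λ z → z ∈[ F , K ⟩) P → μfuel n F z ≡ μfuel (suc n) F z
    stable z∈ =
      let z∈P , z∈[F,K⟩ = ∈-filterᵇ⁻ (λ z → z ∈[ F , K ⟩) z∈
          size<1+n = ℕP.<-≤-trans (intervalSize-shrinks F≤K K∈P z∈[F,K⟩)
                                  (subst (intervalSize F K ≤_) |P|≡ (ListP.length-filter _ P))
      in  μfuel-stable n F _ z∈P (ℕP.≤-pred size<1+n)

  μ-≈ : ∀ {F G K} → K ∈ P → (F ≈ᵇ G) ≡ true → μ F G ≡ + 1
  μ-≈ {F} {G} K∈P F≈G with length P in |P|≡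
  ... | zero  = ⊥-elim (ℕP.<-irrefl (sym |P|≡) (∈-length K∈P))
  ... | suc n rewrite F≈G = refl

  -- The sum formulation says that P lists exactly one element of each ≈-class.
  ListsEachClassOnce : Set
  ListsEachClassOnce =
    ∀ t → ∃ λ t₀ → (t₀ ≈ᵇ t) ≡ true × ∀ (w : A → ℤ) → ∑[ x ← P ] ⟦ x ≈ᵇ t ⟧ w x ≡ w t₀

  module _ (_≟_ : (x y : A) → Dec (x ≡ y)) (eachClassOnce : ListsEachClassOnce) where

    rep : A → A
    rep t = proj₁ (eachClassOnce t)

    rep-≈ : ∀ t → (rep t ≈ᵇ t) ≡ true
    rep-≈ t = proj₁ (proj₂ (eachClassOnce t))

    ∑-class : ∀ t (w : A → ℤ) → ∑[ x ← P ] ⟦ x ≈ᵇ t ⟧ w x ≡ w (rep t)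
    ∑-class t = proj₂ (proj₂ (eachClassOnce t))

    rep-∈ : ∀ t → rep t ∈ P
    rep-∈ t with ∑-nonzero P (λ x → ⟦ x ≈ᵇ t ⟧ ⟦ does (x ≟ rep t) ⟧ + 1) ∑≢0
      where
      ∑≢0 : ¬ ∑[ x ← P ] ⟦ x ≈ᵇ t ⟧ ⟦ does (x ≟ rep t) ⟧ + 1 ≡ + 0
      ∑≢0 ∑≡0 with rep t ≟ rep t | trans (sym (∑-class t (λ x → ⟦ does (x ≟ rep t) ⟧ + 1))) ∑≡0
      ... | yes _ | ()
      ... | no ≢  | _ = ≢ refl
    ... | x , x∈P , term≢0 with x ≈ᵇ t | x ≟ rep t
    ...   | true  | yes refl = x∈P
    ...   | true  | no  _    = ⊥-elim (term≢0 refl)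
    ...   | false | _        = ⊥-elim (term≢0 refl)

    μ-interval-sum-≈ : ∀ {F K} → K ∈ P → (F ≈ᵇ K) ≡ true →
                       ∑[ G ← P ] ⟦ (F ≤ᵇ G) ∧ (G ≤ᵇ K) ⟧ μ F G ≡ + 1
    μ-interval-sum-≈ {F} {K} K∈P F≈K = trans (∑-cong P term) (∑-class K (λ _ → + 1))
      where
      F≤K = proj₁ (∧-elim {F ≤ᵇ K} F≈K)
      K≤F = proj₂ (∧-elim {F ≤ᵇ K} F≈K)
      term : ∀ G → ⟦ (F ≤ᵇ G) ∧ (G ≤ᵇ K) ⟧ μ F G ≡ ⟦ G ≈ᵇ K ⟧ + 1
      term G with G ≈ᵇ K in G≈K
      ... | true  rewrite ≤-trans F≤K (proj₂ (∧-elim {G ≤ᵇ K} G≈K)) | proj₁ (∧-elim {G ≤ᵇ K} G≈K)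
                        = μ-≈ K∈P (≈-trans F≈K (≈-sym G≈K))
      ... | false = ⟦⟧-∧-absurd (F ≤ᵇ G) (G ≤ᵇ K) (μ F G)
                      (λ F≤G G≤K → true≢false (trans (sym (∧-intro G≤K (≤-trans K≤F F≤G))) G≈K))

    μ-interval-sum-< : ∀ {F K} → K ∈ P → (F ≈ᵇ K) ≡ false → (F ≤ᵇ K) ≡ true →
                       ∑[ G ← P ] ⟦ (F ≤ᵇ G) ∧ (G ≤ᵇ K) ⟧ μ F G ≡ + 0
    μ-interval-sum-< {F} {K} K∈P F≉K F≤K = begin
      ∑[ G ← P ] ⟦ (F ≤ᵇ G) ∧ (G ≤ᵇ K) ⟧ μ F G
        ≡⟨ ∑-cong P split ⟩
      ∑[ G ← P ] (⟦ G ∈[ F , K ⟩ ⟧ μ F G ℤ.+ ⟦ G ≈ᵇ K ⟧ μ F G)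
        ≡⟨ ∑-+ P _ _ ⟩
      ∑ P (λ G → ⟦ G ∈[ F , K ⟩ ⟧ μ F G) ℤ.+ ∑ P (λ G → ⟦ G ≈ᵇ K ⟧ μ F G)
        ≡⟨ cong₂ ℤ._+_ (sym (∑-filter P _ (μ F))) (∑-class K (μ F)) ⟩
      ∑ [F,K⟩ (μ F) ℤ.+ μ F (rep K)
        ≡⟨ cong (ℤ._+_ (∑ [F,K⟩ (μ F))) (μfuel-respʳ-≈ (length P) F (rep-≈ K)) ⟩
      ∑ [F,K⟩ (μ F) ℤ.+ μ F K
        ≡⟨ cong (ℤ._+_ (∑ [F,K⟩ (μ F))) (μ-unfold K∈P F≉K F≤K) ⟩
      ∑ [F,K⟩ (μ F) ℤ.- ∑ [F,K⟩ (μ F)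
        ≡⟨ ℤP.+-inverseʳ (∑ [F,K⟩ (μ F)) ⟩
      + 0 ∎
      where
      open ≡-Reasoning
      [F,K⟩ = filterᵇ (λ z → z ∈[ F , K ⟩) P
      split : ∀ G → ⟦ (F ≤ᵇ G) ∧ (G ≤ᵇ K) ⟧ μ F G ≡ ⟦ G ∈[ F , K ⟩ ⟧ μ F G ℤ.+ ⟦ G ≈ᵇ K ⟧ μ F G
      split G with G ≈ᵇ K in G≈K
      ... | true rewrite ≤-trans F≤K (proj₂ (∧-elim {G ≤ᵇ K} G≈K)) | proj₁ (∧-elim {G ≤ᵇ K} G≈K)
                       = sym (ℤP.+-identityˡ _)
      ... | false with F ≤ᵇ G | G ≤ᵇ K
      ...   | true  | true  = sym (ℤP.+-identityʳ _)
      ...   | true  | false = refl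
      ...   | false | _     = refl

    μ-interval-sum : ∀ F K → K ∈ P → ∑[ G ← P ] ⟦ (F ≤ᵇ G) ∧ (G ≤ᵇ K) ⟧ μ F G ≡ ⟦ F ≈ᵇ K ⟧ + 1
    μ-interval-sum F K K∈P with F ≈ᵇ K in F≈K
    ... | true  = μ-interval-sum-≈ K∈P F≈K
    ... | false with F ≤ᵇ K in F≤K
    ...   | true  = μ-interval-sum-< K∈P (trans (cong (_∧ (K ≤ᵇ F)) F≤K) F≈K) F≤K
    ...   | false = ∑-vanishes P (λ G → ⟦⟧-∧-absurd (F ≤ᵇ G) (G ≤ᵇ K) (μ F G)
                      (λ F≤G G≤K → true≢false (trans (sym (≤-trans F≤G G≤K)) F≤K)))

    μ-transform : (A → ℤ) → A → ℤ
    μ-transform f G = ∑[ F ← filterᵇ (λ F → F ≤ᵇ G) P ] μ F G ℤ.* f F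

    inversion : (f : A → ℤ) → (∀ {x y} → (x ≈ᵇ y) ≡ true → f x ≡ f y) →
                ∀ K → ∑[ G ← P ] ⟦ G ≤ᵇ K ⟧ μ-transform f G ≡ f K
    inversion f f-resp K = begin
      ∑[ G ← P ] ⟦ G ≤ᵇ K ⟧ μ-transform f G
        ≡⟨ ∑-cong P (λ G → cong (λ b → ⟦ b ⟧ μ-transform f G) (≤-respʳ-≈ G (≈-sym (rep-≈ K)))) ⟩
      ∑[ G ← P ] ⟦ G ≤ᵇ K′ ⟧ μ-transform f G
        ≡⟨ ∑-cong P (λ G → trans (cong (⟦ G ≤ᵇ K′ ⟧_) (∑-filter P (λ F → F ≤ᵇ G) _))
                                 (∑-⟦⟧ (G ≤ᵇ K′) P _)) ⟩
      ∑[ G ← P ] ∑[ F ← P ] ⟦ G ≤ᵇ K′ ⟧ ⟦ F ≤ᵇ G ⟧ (μ F G ℤ.* f F)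
        ≡⟨ ∑-comm P P _ ⟩
      ∑[ F ← P ] ∑[ G ← P ] ⟦ G ≤ᵇ K′ ⟧ ⟦ F ≤ᵇ G ⟧ (μ F G ℤ.* f F)
        ≡⟨ ∑-cong P (λ F → trans (∑-cong P (λ G → pull-out (G ≤ᵇ K′) (F ≤ᵇ G) (μ F G) (f F)))
                                 (∑-*ˡ P (f F) _)) ⟩
      ∑[ F ← P ] f F ℤ.* ∑ P (λ G → ⟦ (F ≤ᵇ G) ∧ (G ≤ᵇ K′) ⟧ μ F G)
        ≡⟨ ∑-cong P (λ F → trans (cong (f F ℤ.*_) (μ-interval-sum F K′ (rep-∈ K)))
                                 (⟦⟧-*-one (F ≈ᵇ K′) (f F))) ⟩
      ∑[ F ← P ] ⟦ F ≈ᵇ K′ ⟧ f F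
        ≡⟨ ∑-class K′ f ⟩
      f (rep K′)
        ≡⟨ f-resp (≈-trans (rep-≈ K′) (rep-≈ K)) ⟩
      f K ∎
      where
      open ≡-Reasoning
      K′ = rep K
      pull-out : ∀ a b m z → ⟦ a ⟧ ⟦ b ⟧ (m ℤ.* z) ≡ z ℤ.* ⟦ b ∧ a ⟧ m
      pull-out true  true  m z = ℤP.*-comm m z
      pull-out true  false m z = sym (ℤP.*-zeroʳ z)
      pull-out false true  m z = sym (ℤP.*-zeroʳ z)
      pull-out false false m z = sym (ℤP.*-zeroʳ z)

infixl 9 _‼_

_‼_ : {A : Set} → List A → ℕ → Maybe A
[]       ‼ i     = nothing
(x ∷ xs) ‼ zero  = just x
(x ∷ xs) ‼ suc i = xs ‼ i

-- ker xs ⊆ ker ys, positions being compared with ‼ (so also beyond the ends of the lists).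
Refines : {A B : Set} → List A → List B → Set
Refines xs ys = ∀ i j → xs ‼ i ≡ xs ‼ j → ys ‼ i ≡ ys ‼ j

SameKernel : {A B : Set} → List A → List B → Set
SameKernel xs ys = Refines xs ys × Refines ys xs

Refines-reindex : {A B : Set} {xs xs′ : List A} {ys ys′ : List B} (φ : ℕ → ℕ) →
                  (∀ i → xs′ ‼ i ≡ xs ‼ φ i) → (∀ i → ys′ ‼ i ≡ ys ‼ φ i) →
                  Refines xs ys → Refines xs′ ys′
Refines-reindex φ xs′≗ ys′≗ xs⊑ys i j eq =
  trans (ys′≗ i) (trans (xs⊑ys (φ i) (φ j) (trans (sym (xs′≗ i)) (trans eq (xs′≗ j)))) (sym (ys′≗ j)))

-- the position of (xs ++ ys) ‼ i in xs ++ y ∷ ys, where y sits at position length xs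
skip : ℕ → ℕ → ℕ
skip zero    i       = suc i
skip (suc m) zero    = zero
skip (suc m) (suc i) = suc (skip m i)

-- the position in xs ++ ys of (xs ++ y ∷ ys) ‼ i, where y equals xs ‼ l
unskip : ℕ → ℕ → ℕ → ℕ
unskip l m i with ℕP.<-cmp i m
... | tri< _ _ _ = i
... | tri≈ _ _ _ = l
... | tri> _ _ _ = ℕ.pred i

module _ {A : Set} where

  ‼-++ˡ : (xs ys : List A) {i : ℕ} → i < length xs → (xs ++ ys) ‼ i ≡ xs ‼ i
  ‼-++ˡ (x ∷ xs) ys {zero}  _         = refl
  ‼-++ˡ (x ∷ xs) ys {suc i} (s≤s i<n) = ‼-++ˡ xs ys i<n

  ‼-++ʳ : (xs ys : List A) {i : ℕ} → length xs ≤ i → (xs ++ ys) ‼ i ≡ ys ‼ (i ∸ length xs)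
  ‼-++ʳ []       ys _         = refl
  ‼-++ʳ (x ∷ xs) ys {suc i} (s≤s n≤i) = ‼-++ʳ xs ys n≤i

  ‼-length : (xs ys : List A) (y : A) → (xs ++ y ∷ ys) ‼ length xs ≡ just y
  ‼-length xs ys y = trans (‼-++ʳ xs (y ∷ ys) ℕP.≤-refl) (cong ((y ∷ ys) ‼_) (ℕP.n∸n≡0 (length xs)))

  ‼-beyond : (xs : List A) {i : ℕ} → length xs ≤ i → xs ‼ i ≡ nothing
  ‼-beyond []       _         = refl
  ‼-beyond (x ∷ xs) {suc i} (s≤s n≤i) = ‼-beyond xs n≤i

  ‼-nothing⇒≥ : (xs : List A) (i : ℕ) → xs ‼ i ≡ nothing → length xs ≤ i
  ‼-nothing⇒≥ []       i       _  = z≤n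
  ‼-nothing⇒≥ (x ∷ xs) (suc i) eq = s≤s (‼-nothing⇒≥ xs i eq)

  ‼-just⇒< : (xs : List A) (i : ℕ) {a : A} → xs ‼ i ≡ just a → i < length xs
  ‼-just⇒< (x ∷ xs) zero    _  = s≤s z≤n
  ‼-just⇒< (x ∷ xs) (suc i) eq = s≤s (‼-just⇒< xs i eq)

  ‼-within : (xs : List A) {i : ℕ} → i < length xs → ∃ λ a → xs ‼ i ≡ just a
  ‼-within (x ∷ xs) {zero}  _         = x , refl
  ‼-within (x ∷ xs) {suc i} (s≤s i<n) = ‼-within xs i<n

  IndexInjective : List A → Set
  IndexInjective xs = ∀ i j {a} → xs ‼ i ≡ just a → xs ‼ j ≡ just a → i ≡ j

  ‼-skip : (xs ys : List A) (y : A) (i : ℕ) → (xs ++ ys) ‼ i ≡ (xs ++ y ∷ ys) ‼ skip (length xs) i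
  ‼-skip []       ys y i       = refl
  ‼-skip (x ∷ xs) ys y zero    = refl
  ‼-skip (x ∷ xs) ys y (suc i) = ‼-skip xs ys y i

  ‼-unskip : (xs ys : List A) (y : A) (l : ℕ) → xs ‼ l ≡ just y → (i : ℕ) →
             (xs ++ y ∷ ys) ‼ i ≡ (xs ++ ys) ‼ unskip l (length xs) i
  ‼-unskip xs ys y l xs‼l≡y i with ℕP.<-cmp i (length xs)
  ... | tri< i<n _ _ = trans (‼-++ˡ xs (y ∷ ys) i<n) (sym (‼-++ˡ xs ys i<n))
  ... | tri≈ _ refl _ = trans (‼-length xs ys y) (trans (sym xs‼l≡y) (sym (‼-++ˡ xs ys (‼-just⇒< xs l xs‼l≡y))))
  ... | tri> _ _ n<i = after i n<i
    where
    after : ∀ i → length xs < i → (xs ++ y ∷ ys) ‼ i ≡ (xs ++ ys) ‼ ℕ.pred i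
    after (suc j) (s≤s n≤j) = trans (‼-++ʳ xs (y ∷ ys) (ℕP.m≤n⇒m≤1+n n≤j))
      (trans (cong ((y ∷ ys) ‼_) (ℕP.+-∸-assoc 1 n≤j)) (sym (‼-++ʳ xs ys n≤j)))

IndexInjective⇒Refines : {A B : Set} (xs : List A) (ys : List B) → IndexInjective xs →
                         length xs ≡ length ys → Refines xs ys
IndexInjective⇒Refines xs ys inj |xs|≡|ys| i j eq with xs ‼ i in xs‼i
... | just a  = cong (ys ‼_) (inj i j xs‼i (sym eq))
... | nothing = trans (‼-beyond ys (subst (_≤ i) |xs|≡|ys| (‼-nothing⇒≥ xs i xs‼i)))
                      (sym (‼-beyond ys (subst (_≤ j) |xs|≡|ys| (‼-nothing⇒≥ xs j (sym eq)))))

module _ {A B : Set} (X : List A) (Y : List B) (|X|≡|Y| : length X ≡ length Y) {a : A} {c : B} {U : List A} {V : List B} where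

  Refines-drop : Refines (X ++ a ∷ U) (Y ++ c ∷ V) → Refines (X ++ U) (Y ++ V)
  Refines-drop =
    Refines-reindex {xs = X ++ a ∷ U} {X ++ U} {Y ++ c ∷ V} {Y ++ V} (skip (length X)) (‼-skip X U a)
    (λ i → subst (λ n → (Y ++ V) ‼ i ≡ (Y ++ c ∷ V) ‼ skip n i) (sym |X|≡|Y|) (‼-skip Y V c i))

  Refines-insert : ∀ l → X ‼ l ≡ just a → Y ‼ l ≡ just c →
                   Refines (X ++ U) (Y ++ V) → Refines (X ++ a ∷ U) (Y ++ c ∷ V)
  Refines-insert l X‼l≡a Y‼l≡c =
    Refines-reindex {xs = X ++ U} {X ++ a ∷ U} {Y ++ V} {Y ++ c ∷ V} (unskip l (length X)) (‼-unskip X U a l X‼l≡a)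
    (λ i → subst (λ n → (Y ++ c ∷ V) ‼ i ≡ (Y ++ V) ‼ unskip l n i) (sym |X|≡|Y|) (‼-unskip Y V c l Y‼l≡c i))

  Refines-copy : ∀ l → X ‼ l ≡ just a → Refines (X ++ a ∷ U) (Y ++ c ∷ V) → Y ‼ l ≡ just c
  Refines-copy l X‼l≡a X⊑Y =
    let l<|X| = ‼-just⇒< X l X‼l≡a
        same  = trans (‼-++ˡ X (a ∷ U) l<|X|) (trans X‼l≡a (sym (‼-length X U a)))
    in  trans (sym (‼-++ˡ Y (c ∷ V) (subst (l <_) |X|≡|Y| l<|X|)))
              (trans (X⊑Y l (length X) same) (subst (λ n → (Y ++ c ∷ V) ‼ n ≡ just c) (sym |X|≡|Y|) (‼-length Y V c)))

‼-map : {A B : Set} (g : A → B) (xs : List A) (i : ℕ) → map g xs ‼ i ≡ Maybe.map g (xs ‼ i)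
‼-map g []       i       = refl
‼-map g (x ∷ xs) zero    = refl
‼-map g (x ∷ xs) (suc i) = ‼-map g xs i

module _ {A B C : Set} (g : B → C) (xs : List A) (ys : List B) where

  Refines-map⁺ : Refines xs ys → Refines xs (map g ys)
  Refines-map⁺ xs⊑ys i j eq = trans (‼-map g ys i) (trans (cong (Maybe.map g) (xs⊑ys i j eq)) (sym (‼-map g ys j)))

  Refines-map⁻ : (∀ {b b′} → g b ≡ g b′ → b ≡ b′) → Refines xs (map g ys) → Refines xs ys
  Refines-map⁻ g-inj xs⊑gys i j eq =
    map-injective (ys ‼ i) (ys ‼ j) (trans (sym (‼-map g ys i)) (trans (xs⊑gys i j eq) (‼-map g ys j)))
    where
    map-injective : ∀ u v → Maybe.map g u ≡ Maybe.map g v → u ≡ v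
    map-injective nothing  nothing  _  = refl
    map-injective (just u) (just v) eq = cong just (g-inj (MaybeP.just-injective eq))

distinctBy : {A : Set} → (A → A → Bool) → List A → ℕ
distinctBy _≈ᵇ_ []       = 0
distinctBy _≈ᵇ_ (x ∷ xs) = (if any (x ≈ᵇ_) xs then 0 else 1) ℕ.+ distinctBy _≈ᵇ_ xs

distinctℕ-by : ∀ xs → distinctℕ xs ≡ distinctBy ℕ._≡ᵇ_ xs
distinctℕ-by []       = refl
distinctℕ-by (x ∷ xs) = cong ((if any (x ℕ.≡ᵇ_) xs then 0 else 1) ℕ.+_) (distinctℕ-by xs)

distinctMod-by : ∀ p xs → distinctMod p xs ≡ distinctBy (congᵇ p) xs
distinctMod-by p []       = refl
distinctMod-by p (x ∷ xs) = cong ((if any (congᵇ p x) xs then 0 else 1) ℕ.+_) (distinctMod-by p xs)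

distinctBy-≤ : {A : Set} (_≈ᵇ_ : A → A → Bool) (xs : List A) → distinctBy _≈ᵇ_ xs ≤ length xs
distinctBy-≤ _≈ᵇ_ []       = z≤n
distinctBy-≤ _≈ᵇ_ (x ∷ xs) with any (x ≈ᵇ_) xs
... | true  = ℕP.m≤n⇒m≤1+n (distinctBy-≤ _≈ᵇ_ xs)
... | false = s≤s (distinctBy-≤ _≈ᵇ_ xs)

module _ {A B : Set} (_≈ᵇ_ : A → A → Bool) (_∼ᵇ_ : B → B → Bool) where

  SamePattern : List A → List B → Set
  SamePattern xs ys = ∀ i j {a a′ b b′} → xs ‼ i ≡ just a → xs ‼ j ≡ just a′ →
                      ys ‼ i ≡ just b → ys ‼ j ≡ just b′ → (a ≈ᵇ a′) ≡ (b ∼ᵇ b′)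

  distinctBy-pattern : ∀ (xs : List A) (ys : List B) → length xs ≡ length ys → SamePattern xs ys →
                       distinctBy _≈ᵇ_ xs ≡ distinctBy _∼ᵇ_ ys
  distinctBy-pattern []       []       _          _    = refl
  distinctBy-pattern (x ∷ xs) (y ∷ ys) |xs|≡|ys| same =
    cong₂ (λ b n → (if b then 0 else 1) ℕ.+ n)
      (any-pattern xs ys (ℕP.suc-injective |xs|≡|ys|) (λ k xs‼k ys‼k → same 0 (suc k) refl xs‼k refl ys‼k))
      (distinctBy-pattern xs ys (ℕP.suc-injective |xs|≡|ys|) (λ i j → same (suc i) (suc j)))
    where
    any-pattern : ∀ (xs : List A) (ys : List B) → length xs ≡ length ys →
                  (∀ k {a b} → xs ‼ k ≡ just a → ys ‼ k ≡ just b → (x ≈ᵇ a) ≡ (y ∼ᵇ b)) →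
                  any (x ≈ᵇ_) xs ≡ any (y ∼ᵇ_) ys
    any-pattern []       []       _  _  = refl
    any-pattern (a ∷ xs) (b ∷ ys) eq hd =
      cong₂ _∨_ (hd 0 refl refl) (any-pattern xs ys (ℕP.suc-injective eq) (λ k → hd (suc k)))

  SameKernel⇒SamePattern : (∀ {a a′} → (a ≈ᵇ a′) ≡ true → a ≡ a′) → (∀ a → (a ≈ᵇ a) ≡ true) →
                           (∀ {b b′} → (b ∼ᵇ b′) ≡ true → b ≡ b′) → (∀ b → (b ∼ᵇ b) ≡ true) →
                           ∀ {xs ys} → SameKernel xs ys → SamePattern xs ys
  SameKernel⇒SamePattern ≈⇒≡ ≈-refl ∼⇒≡ ∼-refl (⊑ , ⊒) i j {a} {a′} {b} {b′} xs‼i xs‼j ys‼i ys‼j =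
    Bool-ext to from
    where
    to : (a ≈ᵇ a′) ≡ true → (b ∼ᵇ b′) ≡ true
    to a≈a′ with ≈⇒≡ a≈a′
    ... | refl = subst (λ z → (b ∼ᵇ z) ≡ true)
                   (MaybeP.just-injective (trans (sym ys‼i) (trans (⊑ i j (trans xs‼i (sym xs‼j))) ys‼j))) (∼-refl b)
    from : (b ∼ᵇ b′) ≡ true → (a ≈ᵇ a′) ≡ true
    from b∼b′ with ∼⇒≡ b∼b′
    ... | refl = subst (λ z → (a ≈ᵇ z) ≡ true)
                   (MaybeP.just-injective (trans (sym xs‼i) (trans (⊒ i j (trans ys‼i (sym ys‼j))) xs‼j))) (≈-refl a)

distinctℕ-SameKernel : ∀ {xs ys : List ℕ} → length xs ≡ length ys → SameKernel xs ys → distinctℕ xs ≡ distinctℕ ys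
distinctℕ-SameKernel {xs} {ys} |xs|≡|ys| same =
  trans (distinctℕ-by xs)
    (trans (distinctBy-pattern ℕ._≡ᵇ_ ℕ._≡ᵇ_ xs ys |xs|≡|ys|
              (SameKernel⇒SamePattern ℕ._≡ᵇ_ ℕ._≡ᵇ_ ≡ᵇ⇒≡ ≡ᵇ-refl ≡ᵇ⇒≡ ≡ᵇ-refl {xs} {ys} same))
           (sym (distinctℕ-by ys)))

-- Restricted growth strings

‼-upTo : ∀ {n i} → i < n → upTo n ‼ i ≡ just i
‼-upTo = go id
  where
  go : ∀ (f : ℕ → ℕ) {n i} → i < n → List.applyUpTo f n ‼ i ≡ just (f i)
  go f {suc n} {zero}  _         = refl
  go f {suc n} {suc i} (s≤s i<n) = go (f ∘ suc) i<n

IndexInjective-upTo : ∀ n → IndexInjective (upTo n)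
IndexInjective-upTo n i j ‼i ‼j =
  MaybeP.just-injective (trans (sym (‼-upTo (lt i ‼i))) (trans ‼i (trans (sym ‼j) (‼-upTo (lt j ‼j)))))
  where
  lt : ∀ i {a} → upTo n ‼ i ≡ just a → i < n
  lt i ‼i = subst (i <_) (ListP.length-upTo n) (‼-just⇒< (upTo n) i ‼i)

upTo-Refines : ∀ {A : Set} {m} (D : List A) → length D ≡ m → Refines (upTo m) D
upTo-Refines {m = m} D |D|≡m =
  IndexInjective⇒Refines (upTo m) D (IndexInjective-upTo m) (trans (ListP.length-upTo m) (sym |D|≡m))

upTo-++-∷ : ∀ m (G : List ℕ) → upTo m ++ m ∷ G ≡ upTo (suc m) ++ G
upTo-++-∷ m G = trans (sym (ListP.++-assoc (upTo m) [ m ] G)) (cong (_++ G) (ListP.upTo-∷ʳ m))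

∑-upTo-δ : ∀ n {a} (c : ℤ) → a < n → ∑[ l ← upTo n ] ⟦ l ℕ.≡ᵇ a ⟧ c ≡ c
∑-upTo-δ (suc n) {a} c a<1+n = begin
  ∑[ l ← upTo (suc n) ] ⟦ l ℕ.≡ᵇ a ⟧ c
    ≡⟨ cong (λ ls → ∑[ l ← ls ] ⟦ l ℕ.≡ᵇ a ⟧ c) (sym (ListP.upTo-∷ʳ n)) ⟩
  ∑[ l ← upTo n ++ [ n ] ] ⟦ l ℕ.≡ᵇ a ⟧ c
    ≡⟨ ∑-++ (upTo n) [ n ] _ ⟩
  ∑ (upTo n) (λ l → ⟦ l ℕ.≡ᵇ a ⟧ c) ℤ.+ (⟦ n ℕ.≡ᵇ a ⟧ c ℤ.+ + 0)
    ≡⟨ split (ℕP.m<1+n⇒m<n∨m≡n a<1+n) ⟩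
  c ∎
  where
  open ≡-Reasoning
  split : a < n ⊎ a ≡ n → ∑ (upTo n) (λ l → ⟦ l ℕ.≡ᵇ a ⟧ c) ℤ.+ (⟦ n ℕ.≡ᵇ a ⟧ c ℤ.+ + 0) ≡ c
  split (inj₁ a<n) rewrite ∑-upTo-δ n c a<n | ≢⇒≡ᵇ-false (ℕP.>⇒≢ a<n) = ℤP.+-identityʳ c
  split (inj₂ refl) rewrite ≡ᵇ-refl a
    | ∑-cong-∈ (upTo a) {λ l → ⟦ l ℕ.≡ᵇ a ⟧ c}
               (λ l∈ → ⟦⟧-false c (≢⇒≡ᵇ-false (ℕP.<⇒≢ (∈-upTo⁻ l∈))))
    | ∑-zero (upTo a) = trans (ℤP.+-identityˡ _) (ℤP.+-identityʳ c)

∑-rgsFrom-suc : ∀ k m (f : Vec ℕ (suc k) → ℤ) →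
  ∑ (rgsFrom (suc k) m) f ≡ ∑[ l ← upTo (suc m) ] ∑[ G ← rgsFrom k (if l ℕ.≡ᵇ m then suc m else m) ] f (l ∷ G)
∑-rgsFrom-suc k m f =
  trans (∑-concatMap (upTo (suc m)) (λ l → map (l ∷_) (rgsFrom k (if l ℕ.≡ᵇ m then suc m else m))) f)
        (∑-cong (upTo (suc m)) (λ l → ∑-map (rgsFrom k (if l ℕ.≡ᵇ m then suc m else m)) (l ∷_) f))

module _ {A : Set} (_≟_ : (x y : A) → Dec (x ≡ y)) where

  findIndex : (x : A) (D : List A) → (∃ λ l → D ‼ l ≡ just x) ⊎ (∀ l → ¬ D ‼ l ≡ just x)
  findIndex x []      = inj₂ (λ l ())
  findIndex x (d ∷ D) with d ≟ x
  ... | yes refl = inj₁ (0 , refl)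
  ... | no  d≢x with findIndex x D
  ...   | inj₁ (l , D‼l≡x) = inj₁ (suc l , D‼l≡x)
  ...   | inj₂ x∉D = inj₂ λ { zero eq → d≢x (MaybeP.just-injective eq) ; (suc l) eq → x∉D l eq }

  ‼-∷ʳ⁻ : (D : List A) (x : A) (i : ℕ) {a : A} → (D ++ [ x ]) ‼ i ≡ just a →
          D ‼ i ≡ just a ⊎ (i ≡ length D × a ≡ x)
  ‼-∷ʳ⁻ D x i eq with i ℕ.<? length D
  ... | yes i<n = inj₁ (trans (sym (‼-++ˡ D [ x ] i<n)) eq)
  ... | no  i≮n with i ∸ length D in i∸n | trans (sym (‼-++ʳ D [ x ] (ℕP.≮⇒≥ i≮n))) eq
  ...   | zero  | x≡a =
    inj₂ (ℕP.≤-antisym (ℕP.m∸n≡0⇒m≤n i∸n) (ℕP.≮⇒≥ i≮n) , sym (MaybeP.just-injective x≡a))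
  ...   | suc _ | ()

  IndexInjective-∷ʳ : (D : List A) (x : A) → IndexInjective D → (∀ l → ¬ D ‼ l ≡ just x) →
                      IndexInjective (D ++ [ x ])
  IndexInjective-∷ʳ D x inj x∉D i j ‼i ‼j with ‼-∷ʳ⁻ D x i ‼i | ‼-∷ʳ⁻ D x j ‼j
  ... | inj₁ D‼i      | inj₁ D‼j      = inj i j D‼i D‼j
  ... | inj₁ D‼i      | inj₂ (_ , refl) = ⊥-elim (x∉D i D‼i)
  ... | inj₂ (_ , refl) | inj₁ D‼j    = ⊥-elim (x∉D j D‼j)
  ... | inj₂ (i≡ , _) | inj₂ (j≡ , _) = trans i≡ (sym j≡)

  -- Uniqueness of the labelling G₀ of s, phrased through sums over the candidates rgsFrom k m.
  UniqueLabelling : (k m : ℕ) (D : List A) (s : Vec A k) (G₀ : Vec ℕ k) → Set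
  UniqueLabelling k m D s G₀ =
    ∀ (b : Vec ℕ k → Bool) →
      (∀ G → b G ≡ true → SameKernel (upTo m ++ toList G) (D ++ toList s)) →
      (∀ G → SameKernel (upTo m ++ toList G) (D ++ toList s) → b G ≡ true) →
      ∀ (w : Vec ℕ k → ℤ) → ∑[ G ← rgsFrom k m ] ⟦ b G ⟧ w G ≡ w G₀

  Labels : (k m : ℕ) (D : List A) (s : Vec A k) (G₀ : Vec ℕ k) → Set
  Labels k m D s G₀ = SameKernel (upTo m ++ toList G₀) (D ++ toList s) × UniqueLabelling k m D s G₀

  module _ {m : ℕ} (D : List A) (inj : IndexInjective D) (|D|≡m : length D ≡ m) where

    private
      |upTo|≡|D| : length (upTo m) ≡ length D
      |upTo|≡|D| = trans (ListP.length-upTo m) (sym |D|≡m)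

    labels-[] : Labels 0 m D [] []
    labels-[] = sameKernel , only
      where
      sameKernel : SameKernel (upTo m ++ []) (D ++ [])
      sameKernel rewrite ListP.++-identityʳ (upTo m) | ListP.++-identityʳ D =
        upTo-Refines D |D|≡m , IndexInjective⇒Refines D (upTo m) inj (sym |upTo|≡|D|)
      only : UniqueLabelling 0 m D [] []
      only b _ complete w rewrite complete [] sameKernel = ℤP.+-identityʳ (w [])

    labels-old : ∀ {k x s G₀ l} → D ‼ l ≡ just x → Labels k m D s G₀ → Labels (suc k) m D (x ∷ s) (l ∷ G₀)
    labels-old {k} {x} {s} {G₀} {l} D‼l≡x (sameKernel , only) = insert _ sameKernel , only′
      where
      l<m : l < m
      l<m = subst (l <_) |D|≡m (‼-just⇒< D l D‼l≡x)
      insert : ∀ G → SameKernel (upTo m ++ G) (D ++ toList s) → SameKernel (upTo m ++ l ∷ G) (D ++ x ∷ toList s)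
      insert G (⊑ , ⊒) = Refines-insert (upTo m) D |upTo|≡|D| l (‼-upTo l<m) D‼l≡x ⊑ ,
                         Refines-insert D (upTo m) (sym |upTo|≡|D|) l D‼l≡x (‼-upTo l<m) ⊒
      drop : ∀ G → SameKernel (upTo m ++ l ∷ G) (D ++ x ∷ toList s) → SameKernel (upTo m ++ G) (D ++ toList s)
      drop G (⊑ , ⊒) = Refines-drop (upTo m) D |upTo|≡|D| ⊑ , Refines-drop D (upTo m) (sym |upTo|≡|D|) ⊒
      other-label : ∀ {l′} G → l′ < suc m → ¬ l′ ≡ l → ¬ SameKernel (upTo m ++ l′ ∷ G) (D ++ x ∷ toList s)
      other-label {l′} G l′<1+m l′≢l (⊑ , ⊒) with ℕP.m<1+n⇒m<n∨m≡n l′<1+m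
      ... | inj₁ l′<m  = l′≢l (inj l′ l (Refines-copy (upTo m) D |upTo|≡|D| l′ (‼-upTo l′<m) ⊑) D‼l≡x)
      ... | inj₂ refl = ℕP.<⇒≢ l<m (MaybeP.just-injective
                          (trans (sym (‼-upTo l<m)) (Refines-copy D (upTo m) (sym |upTo|≡|D|) l D‼l≡x ⊒)))
      only′ : UniqueLabelling (suc k) m D (x ∷ s) (l ∷ G₀)
      only′ b sound complete w = begin
        ∑[ G ← rgsFrom (suc k) m ] ⟦ b G ⟧ w G
          ≡⟨ ∑-rgsFrom-suc k m _ ⟩
        ∑[ l′ ← upTo (suc m) ] ∑[ G ← rgsFrom k (if l′ ℕ.≡ᵇ m then suc m else m) ] ⟦ b (l′ ∷ G) ⟧ w (l′ ∷ G)
          ≡⟨ ∑-cong-∈ (upTo (suc m)) (λ l′∈ → at-label _ (∈-upTo⁻ l′∈)) ⟩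
        ∑[ l′ ← upTo (suc m) ] ⟦ l′ ℕ.≡ᵇ l ⟧ w (l ∷ G₀)
          ≡⟨ ∑-upTo-δ (suc m) _ (ℕP.m≤n⇒m≤1+n l<m) ⟩
        w (l ∷ G₀) ∎
        where
        open ≡-Reasoning
        at-label : ∀ l′ → l′ < suc m →
          ∑[ G ← rgsFrom k (if l′ ℕ.≡ᵇ m then suc m else m) ] ⟦ b (l′ ∷ G) ⟧ w (l′ ∷ G) ≡
          ⟦ l′ ℕ.≡ᵇ l ⟧ w (l ∷ G₀)
        at-label l′ l′<1+m with l′ ℕ.≟ l
        ... | yes refl rewrite ≢⇒≡ᵇ-false (ℕP.<⇒≢ l<m) | ≡ᵇ-refl l =
          only (b ∘ (l ∷_)) (λ G b≡t → drop _ (sound _ b≡t)) (λ G same → complete _ (insert _ same)) (w ∘ (l ∷_))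
        ... | no l′≢l rewrite ≢⇒≡ᵇ-false l′≢l =
          ∑-vanishes (rgsFrom k (if l′ ℕ.≡ᵇ m then suc m else m)) (λ G → ⟦⟧-false (w (l′ ∷ G)) (b≡false G))
          where
          b≡false : ∀ G → b (l′ ∷ G) ≡ false
          b≡false G with b (l′ ∷ G) in b≡
          ... | true  = ⊥-elim (other-label (toList G) l′<1+m l′≢l (sound _ b≡))
          ... | false = refl

    labels-new : ∀ {k x s G₀} → (∀ l → ¬ D ‼ l ≡ just x) →
                 Labels k (suc m) (D ++ [ x ]) s G₀ → Labels (suc k) m D (x ∷ s) (m ∷ G₀)
    labels-new {k} {x} {s} {G₀} x∉D (sameKernel , only) = shift⁻ _ sameKernel , only′
      where
      shift : ∀ G → SameKernel (upTo m ++ m ∷ G) (D ++ x ∷ toList s) →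
              SameKernel (upTo (suc m) ++ G) ((D ++ [ x ]) ++ toList s)
      shift G = subst₂ SameKernel (upTo-++-∷ m G) (sym (ListP.++-assoc D [ x ] (toList s)))
      shift⁻ : ∀ G → SameKernel (upTo (suc m) ++ G) ((D ++ [ x ]) ++ toList s) →
               SameKernel (upTo m ++ m ∷ G) (D ++ x ∷ toList s)
      shift⁻ G = subst₂ SameKernel (sym (upTo-++-∷ m G)) (ListP.++-assoc D [ x ] (toList s))
      only′ : UniqueLabelling (suc k) m D (x ∷ s) (m ∷ G₀)
      only′ b sound complete w = begin
        ∑[ G ← rgsFrom (suc k) m ] ⟦ b G ⟧ w G
          ≡⟨ ∑-rgsFrom-suc k m _ ⟩
        ∑[ l′ ← upTo (suc m) ] ∑[ G ← rgsFrom k (if l′ ℕ.≡ᵇ m then suc m else m) ] ⟦ b (l′ ∷ G) ⟧ w (l′ ∷ G)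
          ≡⟨ ∑-cong-∈ (upTo (suc m)) (λ l′∈ → at-label _ (∈-upTo⁻ l′∈)) ⟩
        ∑[ l′ ← upTo (suc m) ] ⟦ l′ ℕ.≡ᵇ m ⟧ w (m ∷ G₀)
          ≡⟨ ∑-upTo-δ (suc m) _ ℕP.≤-refl ⟩
        w (m ∷ G₀) ∎
        where
        open ≡-Reasoning
        at-label : ∀ l′ → l′ < suc m →
          ∑[ G ← rgsFrom k (if l′ ℕ.≡ᵇ m then suc m else m) ] ⟦ b (l′ ∷ G) ⟧ w (l′ ∷ G) ≡
          ⟦ l′ ℕ.≡ᵇ m ⟧ w (m ∷ G₀)
        at-label l′ l′<1+m with l′ ℕ.≟ m
        ... | yes refl rewrite ≡ᵇ-refl m =
          only (b ∘ (m ∷_)) (λ G b≡t → shift _ (sound _ b≡t)) (λ G same → complete _ (shift⁻ _ same)) (w ∘ (m ∷_))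
        ... | no l′≢m rewrite ≢⇒≡ᵇ-false l′≢m =
          ∑-vanishes (rgsFrom k m) (λ G → ⟦⟧-false (w (l′ ∷ G)) (b≡false G))
          where
          l′<m = ℕP.≤∧≢⇒< (ℕP.≤-pred l′<1+m) l′≢m
          b≡false : ∀ G → b (l′ ∷ G) ≡ false
          b≡false G with b (l′ ∷ G) in b≡
          ... | true  = ⊥-elim (x∉D l′ (Refines-copy (upTo m) D |upTo|≡|D| l′ (‼-upTo l′<m) (proj₁ (sound _ b≡))))
          ... | false = refl

  labels : ∀ k {m} (D : List A) → IndexInjective D → length D ≡ m → (s : Vec A k) → ∃ (Labels k m D s)
  labels zero    D inj |D|≡m [] = [] , labels-[] D inj |D|≡m
  labels (suc k) D inj |D|≡m (x ∷ s) with findIndex x D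
  ... | inj₁ (l , D‼l≡x) = l ∷ _ , labels-old D inj |D|≡m D‼l≡x (proj₂ (labels k D inj |D|≡m s))
  ... | inj₂ x∉D = _ ∷ _ , labels-new D inj |D|≡m x∉D
          (proj₂ (labels k (D ++ [ x ]) (IndexInjective-∷ʳ D x inj x∉D) |D++x|≡1+m s))
    where
    |D++x|≡1+m = trans (ListP.length-++ D) (trans (ℕP.+-comm (length D) 1) (cong suc |D|≡m))

data RestrictedGrowth : ℕ → ∀ {k} → Vec ℕ k → Set where
  []  : ∀ {m} → RestrictedGrowth m []
  old : ∀ {m k l} {G : Vec ℕ k} → l < m → RestrictedGrowth m G → RestrictedGrowth m (l ∷ G)
  new : ∀ {m k} {G : Vec ℕ k} → RestrictedGrowth (suc m) G → RestrictedGrowth m (m ∷ G)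

∈-rgsFrom⇒RestrictedGrowth : ∀ k m {G : Vec ℕ k} → G ∈ rgsFrom k m → RestrictedGrowth m G
∈-rgsFrom⇒RestrictedGrowth zero    m {[]} _ = []
∈-rgsFrom⇒RestrictedGrowth (suc k) m G∈ with find (∈-concatMap⁻ _ {xs = upTo (suc m)} G∈)
... | l , l∈ , G∈l∷ with ∈-map⁻ (l ∷_) G∈l∷ | ℕP.m<1+n⇒m<n∨m≡n (∈-upTo⁻ l∈)
...   | G′ , G′∈ , refl | inj₁ l<m rewrite ≢⇒≡ᵇ-false (ℕP.<⇒≢ l<m) =
        old l<m (∈-rgsFrom⇒RestrictedGrowth k m G′∈)
...   | G′ , G′∈ , refl | inj₂ refl rewrite ≡ᵇ-refl l = new (∈-rgsFrom⇒RestrictedGrowth k (suc l) G′∈)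

newLabels : ∀ {k} → ℕ → Vec ℕ k → ℕ
newLabels m []      = 0
newLabels m (l ∷ G) = if l ℕ.≡ᵇ m then suc (newLabels (suc m) G) else newLabels m G

module _ (p : ℕ) where

  count-refining : ∀ {k m} {G : Vec ℕ k} → RestrictedGrowth m G → (D : List (Fin p)) → length D ≡ m →
    (b : Vec (Fin p) k → Bool) →
    (∀ y → b y ≡ true → Refines (upTo m ++ toList G) (D ++ toList y)) →
    (∀ y → Refines (upTo m ++ toList G) (D ++ toList y) → b y ≡ true) →
    ∑[ y ← allVec p k ] ⟦ b y ⟧ + 1 ≡ + (p ^ newLabels m G)
  count-refining {m = m} [] D |D|≡m b sound complete
    rewrite complete [] (subst₂ Refines (sym (ListP.++-identityʳ (upTo m))) (sym (ListP.++-identityʳ D))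
                          (upTo-Refines D |D|≡m)) = refl
  count-refining {suc k} {m} {l ∷ G} (old l<m rg) D |D|≡m b sound complete
    with ‼-within D (subst (l <_) (sym |D|≡m) l<m)
  ... | d , D‼l≡d rewrite ≢⇒≡ᵇ-false (ℕP.<⇒≢ l<m) =
    trans (∑-allVec-suc p k _) (trans (∑-cong (allFin p) forced) (∑-allFin-δ p d _))
    where
    |upTo|≡|D| = trans (ListP.length-upTo m) (sym |D|≡m)
    forced : ∀ x → ∑[ y ← allVec p k ] ⟦ b (x ∷ y) ⟧ + 1 ≡ ⟦ does (x FinP.≟ d) ⟧ + (p ^ newLabels m G)
    forced x with x FinP.≟ d
    ... | yes refl = count-refining rg D |D|≡m (λ y → b (x ∷ y))
                       (λ y b≡t → Refines-drop (upTo m) D |upTo|≡|D| (sound _ b≡t))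
                       (λ y ⊑ → complete _ (Refines-insert (upTo m) D |upTo|≡|D| l (‼-upTo l<m) D‼l≡d ⊑))
    ... | no x≢d = ∑-vanishes (allVec p k) (λ y → ⟦⟧-false (+ 1) (b≡false y))
      where
      b≡false : ∀ y → b (x ∷ y) ≡ false
      b≡false y with b (x ∷ y) in b≡
      ... | true  = ⊥-elim (x≢d (MaybeP.just-injective
                      (trans (sym (Refines-copy (upTo m) D |upTo|≡|D| l (‼-upTo l<m) (sound _ b≡))) D‼l≡d)))
      ... | false = refl
  count-refining {suc k} {m} {m ∷ G} (new rg) D |D|≡m b sound complete rewrite ≡ᵇ-refl m = begin
    ∑[ y ← allVec p (suc k) ] ⟦ b y ⟧ + 1
      ≡⟨ ∑-allVec-suc p k _ ⟩
    ∑[ x ← allFin p ] ∑[ y ← allVec p k ] ⟦ b (x ∷ y) ⟧ + 1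
      ≡⟨ ∑-cong (allFin p) fresh ⟩
    ∑[ x ← allFin p ] + (p ^ newLabels (suc m) G)
      ≡⟨ ∑-allFin-const p _ ⟩
    + (p ^ newLabels (suc m) G) ℤ.* + p
      ≡⟨ ℤP.pos-* (p ^ newLabels (suc m) G) p ⟨
    + (p ^ newLabels (suc m) G ℕ.* p)
      ≡⟨ cong +_ (ℕP.*-comm (p ^ newLabels (suc m) G) p) ⟩
    + (p ^ suc (newLabels (suc m) G)) ∎
    where
    open ≡-Reasoning
    fresh : ∀ x → ∑[ y ← allVec p k ] ⟦ b (x ∷ y) ⟧ + 1 ≡ + (p ^ newLabels (suc m) G)
    fresh x = count-refining rg (D ++ [ x ])
      (trans (ListP.length-++ D) (trans (ℕP.+-comm (length D) 1) (cong suc |D|≡m))) (λ y → b (x ∷ y))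
      (λ y b≡t → subst₂ Refines (upTo-++-∷ m _) (sym (ListP.++-assoc D [ x ] _)) (sound _ b≡t))
      (λ y ⊑ → complete _ (subst₂ Refines (sym (upTo-++-∷ m _)) (ListP.++-assoc D [ x ] _) ⊑))

distinctℕ-∷ʳ : ∀ xs a → distinctℕ (xs ++ [ a ]) ≡ distinctℕ xs ℕ.+ (if any (a ℕ.≡ᵇ_) xs then 0 else 1)
distinctℕ-∷ʳ []       a = refl
distinctℕ-∷ʳ (x ∷ xs) a rewrite any-++ (x ℕ.≡ᵇ_) xs [ a ] | distinctℕ-∷ʳ xs a with x ℕ.≟ a
... | yes refl rewrite ≡ᵇ-refl x | BoolP.∨-zeroʳ (any (x ℕ.≡ᵇ_) xs) =
  trans (ℕP.+-comm (distinctℕ xs) _) (sym (ℕP.+-identityʳ _))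
... | no x≢a rewrite ≢⇒≡ᵇ-false x≢a | ≢⇒≡ᵇ-false (x≢a ∘ sym) | BoolP.∨-identityʳ (any (x ℕ.≡ᵇ_) xs) =
  sym (ℕP.+-assoc (if any (x ℕ.≡ᵇ_) xs then 0 else 1) (distinctℕ xs) _)

LabelsBelow : ℕ → List ℕ → Set
LabelsBelow m ls = ∀ v → (any (v ℕ.≡ᵇ_) ls ≡ true → v < m) × (v < m → any (v ℕ.≡ᵇ_) ls ≡ true)

LabelsBelow-old : ∀ {m l} ls → l < m → LabelsBelow m ls → LabelsBelow m (ls ++ [ l ])
LabelsBelow-old {m} {l} ls l<m below v rewrite any-++ (v ℕ.≡ᵇ_) ls [ l ] =
  [ proj₁ (below v) , at-l ]′ ∘ ∨-true⁻ , λ v<m → cong (_∨ _) (proj₂ (below v) v<m)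
  where
  at-l : (v ℕ.≡ᵇ l) ∨ false ≡ true → v < m
  at-l v≡l with ∨-true⁻ {v ℕ.≡ᵇ l} v≡l
  ... | inj₁ v≡ᵇl = subst (_< m) (sym (≡ᵇ⇒≡ v≡ᵇl)) l<m

LabelsBelow-new : ∀ {m} ls → LabelsBelow m ls → LabelsBelow (suc m) (ls ++ [ m ])
LabelsBelow-new {m} ls below v rewrite any-++ (v ℕ.≡ᵇ_) ls [ m ] =
  [ ℕP.m≤n⇒m≤1+n ∘ proj₁ (below v) , at-m ]′ ∘ ∨-true⁻ , [ old-label , new-label ]′ ∘ ℕP.m<1+n⇒m<n∨m≡n
  where
  at-m : (v ℕ.≡ᵇ m) ∨ false ≡ true → v < suc m
  at-m v≡m with ∨-true⁻ {v ℕ.≡ᵇ m} v≡m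
  ... | inj₁ v≡ᵇm = subst (_< suc m) (sym (≡ᵇ⇒≡ v≡ᵇm)) ℕP.≤-refl
  old-label : v < m → any (v ℕ.≡ᵇ_) ls ∨ ((v ℕ.≡ᵇ m) ∨ false) ≡ true
  old-label v<m rewrite proj₂ (below v) v<m = refl
  new-label : v ≡ m → any (v ℕ.≡ᵇ_) ls ∨ ((v ℕ.≡ᵇ m) ∨ false) ≡ true
  new-label refl rewrite ≡ᵇ-refl v = BoolP.∨-zeroʳ _

LabelsBelow-fresh : ∀ {m} ls → LabelsBelow m ls → any (m ℕ.≡ᵇ_) ls ≡ false
LabelsBelow-fresh {m} ls below with any (m ℕ.≡ᵇ_) ls in m∈ls
... | true  = ⊥-elim (ℕP.<-irrefl refl (proj₁ (below m) m∈ls))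
... | false = refl

distinctℕ-++-RestrictedGrowth : ∀ {k m} {G : Vec ℕ k} → RestrictedGrowth m G → ∀ ls → LabelsBelow m ls →
                                distinctℕ (ls ++ toList G) ≡ distinctℕ ls ℕ.+ newLabels m G
distinctℕ-++-RestrictedGrowth [] ls _ rewrite ListP.++-identityʳ ls = sym (ℕP.+-identityʳ _)
distinctℕ-++-RestrictedGrowth {m = m} {l ∷ G} (old l<m rg) ls below
  rewrite sym (ListP.++-assoc ls [ l ] (toList G))
        | distinctℕ-++-RestrictedGrowth rg (ls ++ [ l ]) (LabelsBelow-old ls l<m below)
        | distinctℕ-∷ʳ ls l | proj₂ (below l) l<m | ≢⇒≡ᵇ-false (ℕP.<⇒≢ l<m)
        = cong (ℕ._+ newLabels m G) (ℕP.+-identityʳ _)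
distinctℕ-++-RestrictedGrowth {m = m} {m ∷ G} (new rg) ls below
  rewrite sym (ListP.++-assoc ls [ m ] (toList G))
        | distinctℕ-++-RestrictedGrowth rg (ls ++ [ m ]) (LabelsBelow-new ls below)
        | distinctℕ-∷ʳ ls m | LabelsBelow-fresh ls below | ≡ᵇ-refl m
        = ℕP.+-assoc (distinctℕ ls) 1 _

numBlocks-RestrictedGrowth : ∀ {k} {G : Vec ℕ k} → RestrictedGrowth 0 G → numBlocks G ≡ newLabels 0 G
numBlocks-RestrictedGrowth rg = distinctℕ-++-RestrictedGrowth rg [] (λ v → (λ ()) , (λ ()))

module _ {A : Set} {n : ℕ} (v : Vec A n) where

  ‼-toList : (i : Fin n) → toList v ‼ toℕ i ≡ just (Vec.lookup v i)
  ‼-toList i = go v i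
    where
    go : ∀ {n} (v : Vec A n) (i : Fin n) → toList v ‼ toℕ i ≡ just (Vec.lookup v i)
    go (x ∷ v) Fin.zero    = refl
    go (x ∷ v) (Fin.suc i) = go v i

  ‼-toList-< : ∀ {j} (j<n : j < n) → toList v ‼ j ≡ just (Vec.lookup v (fromℕ< j<n))
  ‼-toList-< {j} j<n =
    subst (λ k → toList v ‼ k ≡ just (Vec.lookup v (fromℕ< j<n))) (FinP.toℕ-fromℕ< j<n) (‼-toList (fromℕ< j<n))

  ‼-toList-≥ : ∀ {j} → n ≤ j → toList v ‼ j ≡ nothing
  ‼-toList-≥ n≤j = ‼-beyond (toList v) (subst (_≤ _) (sym (VecP.length-toList v)) n≤j)

module _ {r : ℕ} where

  ≼⇒Refines : (F G : SetPartition r) → (F ≼ᵇ G) ≡ true → Refines (toList F) (toList G)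
  ≼⇒Refines F G F≼G i j F‼i≡F‼j with i ℕ.<? r | j ℕ.<? r
  ... | yes i<r | yes j<r =
    trans (‼-toList-< G i<r) (trans (cong just (≡ᵇ⇒≡ sameG)) (sym (‼-toList-< G j<r)))
    where
    i′ = fromℕ< i<r
    j′ = fromℕ< j<r
    sameF : sameBlock F i′ j′ ≡ true
    sameF = subst (λ z → (Vec.lookup F i′ ℕ.≡ᵇ z) ≡ true)
      (MaybeP.just-injective (trans (sym (‼-toList-< F i<r)) (trans F‼i≡F‼j (‼-toList-< F j<r))))
      (≡ᵇ-refl (Vec.lookup F i′))
    implied : not (sameBlock F i′ j′) ∨ sameBlock G i′ j′ ≡ true
    implied = all-true⁻ _ (all-true⁻ _ F≼G (∈-allFin i′)) (∈-allFin j′)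
    sameG : sameBlock G i′ j′ ≡ true
    sameG = modus-ponens (sameBlock F i′ j′) sameF implied
      where
      modus-ponens : ∀ a {b} → a ≡ true → not a ∨ b ≡ true → b ≡ true
      modus-ponens true refl b≡t = b≡t
  ... | yes i<r | no j≮r with () ← trans (sym (‼-toList-< F i<r)) (trans F‼i≡F‼j (‼-toList-≥ F (ℕP.≮⇒≥ j≮r)))
  ... | no i≮r | yes j<r with () ← trans (sym (‼-toList-< F j<r)) (trans (sym F‼i≡F‼j) (‼-toList-≥ F (ℕP.≮⇒≥ i≮r)))
  ... | no i≮r | no j≮r = trans (‼-toList-≥ G (ℕP.≮⇒≥ i≮r)) (sym (‼-toList-≥ G (ℕP.≮⇒≥ j≮r)))

  Refines⇒≼ : (F G : SetPartition r) → Refines (toList F) (toList G) → (F ≼ᵇ G) ≡ true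
  Refines⇒≼ F G F⊑G = all-true⁺ _ (allFin r) (λ {i} _ → all-true⁺ _ (allFin r) (λ {j} _ → implied i j))
    where
    implied : ∀ i j → not (sameBlock F i j) ∨ sameBlock G i j ≡ true
    implied i j with sameBlock F i j in sameF
    ... | false = refl
    ... | true  = subst (λ z → (Vec.lookup G i ℕ.≡ᵇ z) ≡ true)
      (MaybeP.just-injective (trans (sym (‼-toList G i)) (trans (F⊑G (toℕ i) (toℕ j)
        (trans (‼-toList F i) (trans (cong just (≡ᵇ⇒≡ sameF)) (sym (‼-toList F j))))) (‼-toList G j))))
      (≡ᵇ-refl (Vec.lookup G i))

  ≼-refl : (F : SetPartition r) → (F ≼ᵇ F) ≡ true
  ≼-refl F = Refines⇒≼ F F (λ i j eq → eq)

  ≼-trans : {F G H : SetPartition r} → (F ≼ᵇ G) ≡ true → (G ≼ᵇ H) ≡ true → (F ≼ᵇ H) ≡ true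
  ≼-trans {F} {G} {H} F≼G G≼H = Refines⇒≼ F H (λ i j eq → ≼⇒Refines G H G≼H i j (≼⇒Refines F G F≼G i j eq))

∑2^codim : ℕ → ℕ → ℤ
∑2^codim p r = ∑[ y ← allVec p r ] + (2 ^ (r ∸ numBlocks (Vec.map toℕ y)))

module Partitions (r : ℕ) where

  open MobiusInversion (setPartitions r) _≼ᵇ_ ≼-refl (λ {F} {G} {H} → ≼-trans {r} {F} {G} {H}) public

  ≈⇒SameKernel : ∀ {F G : SetPartition r} → (F ≈ᵇ G) ≡ true → SameKernel (toList F) (toList G)
  ≈⇒SameKernel {F} {G} F≈G = let F≼G , G≼F = ∧-elim {F ≼ᵇ G} F≈G in ≼⇒Refines F G F≼G , ≼⇒Refines G F G≼F

  SameKernel⇒≈ : ∀ {F G : SetPartition r} → SameKernel (toList F) (toList G) → (F ≈ᵇ G) ≡ true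
  SameKernel⇒≈ {F} {G} (⊑ , ⊒) = ∧-intro (Refines⇒≼ F G ⊑) (Refines⇒≼ G F ⊒)

  setPartitions-eachClassOnce : ListsEachClassOnce
  setPartitions-eachClassOnce t =
    let G₀ , sameKernel , only = labels ℕ._≟_ r [] (λ _ _ ()) refl t
    in  G₀ , SameKernel⇒≈ {G₀} {t} sameKernel ,
        only (λ G → G ≈ᵇ t) (λ G → ≈⇒SameKernel {G} {t}) (λ G → SameKernel⇒≈ {G} {t})

  numBlocks-≈ : ∀ {F G : SetPartition r} → (F ≈ᵇ G) ≡ true → numBlocks F ≡ numBlocks G
  numBlocks-≈ {F} {G} F≈G = distinctℕ-SameKernel {toList F} {toList G}
    (trans (VecP.length-toList F) (sym (VecP.length-toList G))) (≈⇒SameKernel {F} {G} F≈G)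

  -- λP r is by definition the μ-transform of F ↦ 2^codimV F.
  ∑-λP-below : ∀ (t : Vec ℕ r) → ∑[ G ← setPartitions r ] ⟦ G ≼ᵇ t ⟧ λP r G ≡ + (2 ^ (r ∸ numBlocks t))
  ∑-λP-below = inversion (VecP.≡-dec ℕ._≟_) setPartitions-eachClassOnce (λ F → + (2 ^ codimV F))
    (λ {F} {G} F≈G → cong (λ n → + (2 ^ (r ∸ n))) (numBlocks-≈ {F} {G} F≈G))

  count-coarser : ∀ p {G} → G ∈ setPartitions r →
                  ∑[ y ← allVec p r ] ⟦ G ≼ᵇ Vec.map toℕ y ⟧ + 1 ≡ + (p ^ numBlocks G)
  count-coarser p {G} G∈ = trans
    (count-refining p rg [] refl (λ y → G ≼ᵇ Vec.map toℕ y)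
      (λ y G≼y → Refines-map⁻ toℕ (toList G) (toList y) FinP.toℕ-injective
                   (subst (Refines (toList G)) (VecP.toList-map toℕ y) (≼⇒Refines G (Vec.map toℕ y) G≼y)))
      (λ y G⊑y → Refines⇒≼ G (Vec.map toℕ y) (subst (Refines (toList G)) (sym (VecP.toList-map toℕ y))
                   (Refines-map⁺ toℕ (toList G) (toList y) G⊑y))))
    (cong (λ n → + (p ^ n)) (sym (numBlocks-RestrictedGrowth rg)))
    where
    rg = ∈-rgsFrom⇒RestrictedGrowth r 0 G∈

  ∑-λP-weighted : ∀ p → ∑[ G ← setPartitions r ] λP r G ℤ.* + (p ^ numBlocks G) ≡ ∑2^codim p r
  ∑-λP-weighted p = begin
    ∑[ G ← setPartitions r ] λP r G ℤ.* + (p ^ numBlocks G)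
      ≡⟨ ∑-cong-∈ (setPartitions r) (λ {G} G∈ → trans (cong (λP r G ℤ.*_) (sym (count-coarser p G∈)))
                                                      (sym (∑-*ˡ (allVec p r) (λP r G) _))) ⟩
    ∑[ G ← setPartitions r ] ∑[ y ← allVec p r ] λP r G ℤ.* ⟦ G ≼ᵇ Vec.map toℕ y ⟧ + 1
      ≡⟨ ∑-comm (setPartitions r) (allVec p r) _ ⟩
    ∑[ y ← allVec p r ] ∑[ G ← setPartitions r ] λP r G ℤ.* ⟦ G ≼ᵇ Vec.map toℕ y ⟧ + 1
      ≡⟨ ∑-cong (allVec p r) (λ y → trans (∑-cong (setPartitions r) (λ G → ⟦⟧-*-one (G ≼ᵇ Vec.map toℕ y) (λP r G)))
                                          (∑-λP-below (Vec.map toℕ y))) ⟩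
    ∑[ y ← allVec p r ] + (2 ^ (r ∸ numBlocks (Vec.map toℕ y))) ∎
    where open ≡-Reasoning

congᵇ-sym : ∀ p a b → congᵇ p a b ≡ congᵇ p b a
congᵇ-sym p a b = cong (λ n → ⌊ p ℕDiv.∣? n ⌋) (ℤP.∣i-j∣≡∣j-i∣ a b)

module ModularArithmetic (p : ℕ) (p>0 : 0 < p) where

  instance
    p≢0 : ℕ.NonZero p
    p≢0 = ℕ.>-nonZero p>0

  infix 4 _≈_

  -- A record rather than a synonym, so that a and b can be inferred from a proof of a ≈ b.
  record _≈_ (a b : ℤ) : Set where
    constructor mk≈
    field p∣a-b : + p ℤ∣.∣ a ℤ.- b
  open _≈_

  congᵇ-sound : ∀ {a b} → congᵇ p a b ≡ true → a ≈ b
  congᵇ-sound {a} {b} eq with p ℕDiv.∣? ∣ a ℤ.- b ∣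
  ... | yes p∣a-b = mk≈ (ℤ∣.∣ᵤ⇒∣ p∣a-b)

  congᵇ-complete : ∀ {a b} → a ≈ b → congᵇ p a b ≡ true
  congᵇ-complete {a} {b} a≈b with p ℕDiv.∣? ∣ a ℤ.- b ∣
  ... | yes _   = refl
  ... | no  p∤ = ⊥-elim (p∤ (ℤ∣.∣⇒∣ᵤ (p∣a-b a≈b)))

  ≈-reflexive : ∀ {a b} → a ≡ b → a ≈ b
  ≈-reflexive {a} refl = mk≈ (ℤ∣.divides (+ 0) (ℤP.+-inverseʳ a))

  ≈-refl : ∀ {a} → a ≈ a
  ≈-refl {a} = ≈-reflexive {a} refl

  ≈-sym : ∀ {a b} → a ≈ b → b ≈ a
  ≈-sym {a} {b} (mk≈ p∣) = mk≈ (subst (+ p ℤ∣.∣_) (negate-minus a b) (ℤ∣.∣m⇒∣-m p∣))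
    where
    negate-minus : ∀ a b → ℤ.- (a ℤ.- b) ≡ b ℤ.- a
    negate-minus = solve-∀

  ≈-trans : ∀ {a b c} → a ≈ b → b ≈ c → a ≈ c
  ≈-trans {a} {b} {c} (mk≈ p∣₁) (mk≈ p∣₂) =
    mk≈ (subst (+ p ℤ∣.∣_) (telescope a b c) (ℤ∣.∣m∣n⇒∣m+n p∣₁ p∣₂))
    where
    telescope : ∀ a b c → (a ℤ.- b) ℤ.+ (b ℤ.- c) ≡ a ℤ.- c
    telescope = solve-∀

  +-cong : ∀ {a b c d} → a ≈ b → c ≈ d → a ℤ.+ c ≈ b ℤ.+ d
  +-cong {a} {b} {c} {d} (mk≈ p∣₁) (mk≈ p∣₂) =
    mk≈ (subst (+ p ℤ∣.∣_) (regroup a b c d) (ℤ∣.∣m∣n⇒∣m+n p∣₁ p∣₂))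
    where
    regroup : ∀ a b c d → (a ℤ.- b) ℤ.+ (c ℤ.- d) ≡ (a ℤ.+ c) ℤ.- (b ℤ.+ d)
    regroup = solve-∀

  *-cong : ∀ {a b c d} → a ≈ b → c ≈ d → a ℤ.* c ≈ b ℤ.* d
  *-cong {a} {b} {c} {d} (mk≈ p∣₁) (mk≈ p∣₂) =
    mk≈ (subst (+ p ℤ∣.∣_) (regroup a b c d) (ℤ∣.∣m∣n⇒∣m+n (ℤ∣.∣n⇒∣m*n a p∣₂) (ℤ∣.∣n⇒∣m*n d p∣₁)))
    where
    regroup : ∀ a b c d → a ℤ.* (c ℤ.- d) ℤ.+ d ℤ.* (a ℤ.- b) ≡ a ℤ.* c ℤ.- b ℤ.* d
    regroup = solve-∀

  +-cancelʳ : ∀ {a b} z → a ℤ.+ z ≈ b ℤ.+ z → a ≈ b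
  +-cancelʳ {a} {b} z (mk≈ p∣) = mk≈ (subst (+ p ℤ∣.∣_) (cancel a b z) p∣)
    where
    cancel : ∀ a b z → (a ℤ.+ z) ℤ.- (b ℤ.+ z) ≡ a ℤ.- b
    cancel = solve-∀

  ≈⇒-≈0 : ∀ {a b} → a ≈ b → a ℤ.- b ≈ + 0
  ≈⇒-≈0 {a} {b} (mk≈ p∣) = mk≈ (subst (+ p ℤ∣.∣_) (sym (ℤP.+-identityʳ (a ℤ.- b))) p∣)

  -≈0⇒≈ : ∀ {a b} → a ℤ.- b ≈ + 0 → a ≈ b
  -≈0⇒≈ {a} {b} (mk≈ p∣) = mk≈ (subst (+ p ℤ∣.∣_) (ℤP.+-identityʳ (a ℤ.- b)) p∣)

  ≈0-product : Prime p → ∀ a b → a ℤ.* b ≈ + 0 → a ≈ + 0 ⊎ b ≈ + 0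
  ≈0-product p-prime a b (mk≈ p∣ab) with
    euclidsLemma ∣ a ∣ ∣ b ∣ p-prime
      (subst (p ℕDiv.∣_) (trans (cong ∣_∣ (ℤP.+-identityʳ (a ℤ.* b))) (ℤP.abs-* a b)) (ℤ∣.∣⇒∣ᵤ p∣ab))
  ... | inj₁ p∣a = inj₁ (mk≈ (ℤ∣.∣ᵤ⇒∣ (subst (p ℕDiv.∣_) (cong ∣_∣ (sym (ℤP.+-identityʳ a))) p∣a)))
  ... | inj₂ p∣b = inj₂ (mk≈ (ℤ∣.∣ᵤ⇒∣ (subst (p ℕDiv.∣_) (cong ∣_∣ (sym (ℤP.+-identityʳ b))) p∣b)))

  residue-injective : ∀ {x y : Fin p} → res x ≈ res y → x ≡ y
  residue-injective {x} {y} x≈y =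
    FinP.toℕ-injective (ℤP.+-injective (ℤP.i-j≡0⇒i≡j _ _ (ℤP.∣i∣≡0⇒i≡0 ∣x-y∣≡0)))
    where
    ∣x-y∣<p : ∣ res x ℤ.- res y ∣ < p
    ∣x-y∣<p = subst (_< p) (cong ∣_∣ (sym (ℤP.m-n≡m⊖n (toℕ x) (toℕ y))))
                (ℕP.≤-<-trans (ℤP.∣m⊝n∣≤m⊔n (toℕ x) (toℕ y)) (ℕP.⊔-lub (FinP.toℕ<n x) (FinP.toℕ<n y)))
    small-multiple : ∀ d → d < p → p ℕDiv.∣ d → d ≡ 0
    small-multiple zero    _   _   = refl
    small-multiple (suc d) d<p p∣d = ⊥-elim (ℕP.<⇒≱ d<p (ℕDiv.∣⇒≤ p∣d))
    ∣x-y∣≡0 = small-multiple _ ∣x-y∣<p (ℤ∣.∣⇒∣ᵤ (p∣a-b x≈y))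

  residue : ℤ → Fin p
  residue a = fromℕ< (n%ℕd<d a p)

  residue-≈ : ∀ a → a ≈ res (residue a)
  residue-≈ a = mk≈ (ℤ∣.divides (a /ℕ p) (begin
    a ℤ.- res (residue a)              ≡⟨ cong (λ n → a ℤ.- + n) (FinP.toℕ-fromℕ< (n%ℕd<d a p)) ⟩
    a ℤ.- + (a %ℕ p)                   ≡⟨ cong (ℤ._- + (a %ℕ p)) (a≡a%ℕn+[a/ℕn]*n a p) ⟩
    + (a %ℕ p) ℤ.+ (a /ℕ p) ℤ.* + p ℤ.- + (a %ℕ p) ≡⟨ cancel (+ (a %ℕ p)) ((a /ℕ p) ℤ.* + p) ⟩
    (a /ℕ p) ℤ.* + p                   ∎))
    where
    open ≡-Reasoning
    cancel : ∀ r s → r ℤ.+ s ℤ.- r ≡ s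
    cancel = solve-∀

  ∑-residues-δ : ∀ a c → ∑[ x ← allFin p ] ⟦ congᵇ p (res x) a ⟧ c ≡ c
  ∑-residues-δ a = ∑-allFin-unique (λ x → congᵇ p (res x) a) (residue a)
    (λ x x≈a → residue-injective (≈-trans (congᵇ-sound x≈a) (residue-≈ a)))
    (congᵇ-complete (≈-sym (residue-≈ a)))

-- Squares modulo p

module Squares (p : ℕ) (p>0 : 0 < p) (p-prime : Prime p) (p>2 : 2 < p) where

  open ModularArithmetic p p>0

  0ₚ : Fin p
  0ₚ = fromℕ< p>0

  res-0ₚ : res 0ₚ ≡ + 0
  res-0ₚ = cong +_ (FinP.toℕ-fromℕ< p>0)

  ≈0⇒≡0ₚ : ∀ {x} → res x ≈ + 0 → x ≡ 0ₚ
  ≈0⇒≡0ₚ x≈0 = residue-injective (≈-trans x≈0 (≈-reflexive (sym res-0ₚ)))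

  IsRootOf : Fin p → Fin p → Bool
  IsRootOf y x = congᵇ p (res x ℤ.* res x) (res y)

  roots : Fin p → ℤ
  roots y = ∑[ x ← allFin p ] ⟦ IsRootOf y x ⟧ + 1

  0²≡0 : res 0ₚ ℤ.* res 0ₚ ≡ res 0ₚ
  0²≡0 = trans (cong (λ z → z ℤ.* z) res-0ₚ) (sym res-0ₚ)

  0ₚ-root : IsRootOf 0ₚ 0ₚ ≡ true
  0ₚ-root = congᵇ-complete (≈-reflexive 0²≡0)

  roots-0ₚ : roots 0ₚ ≡ + 1
  roots-0ₚ = ∑-allFin-unique (IsRootOf 0ₚ) 0ₚ root⇒0ₚ 0ₚ-root (+ 1)
    where
    root⇒0ₚ : ∀ x → IsRootOf 0ₚ x ≡ true → x ≡ 0ₚ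
    root⇒0ₚ x x²≈0 = [ ≈0⇒≡0ₚ , ≈0⇒≡0ₚ ]′
      (≈0-product p-prime (res x) (res x) (≈-trans (congᵇ-sound {res x ℤ.* res x} x²≈0) (≈-reflexive res-0ₚ)))

  roots-nonsquare : ∀ y → isSquare y ≡ false → roots y ≡ + 0
  roots-nonsquare y nonsquare = trans (∑-cong-∈ (allFin p)
    (λ x∈ → ⟦⟧-false (+ 1) (any-false⁻ (IsRootOf y) nonsquare x∈))) (∑-zero (allFin p))

  -- A nonzero square y = x₀² has exactly the two roots x₀ and -x₀, which differ as p is odd.
  module _ (y : Fin p) (x₀ : Fin p) (x₀²≈y : res x₀ ℤ.* res x₀ ≈ res y) (x₀≢0 : ¬ x₀ ≡ 0ₚ) where

    x₁ : Fin p
    x₁ = residue (ℤ.- res x₀)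

    x₁≢x₀ : ¬ x₁ ≡ x₀
    x₁≢x₀ x₁≡x₀ = [ 2≉0 , x₀≢0 ∘ ≈0⇒≡0ₚ ]′ (≈0-product p-prime (+ 2) (res x₀) 2x₀≈0)
      where
      -x₀≈x₀ : ℤ.- res x₀ ≈ res x₀
      -x₀≈x₀ = subst (λ x → ℤ.- res x₀ ≈ res x) x₁≡x₀ (residue-≈ (ℤ.- res x₀))
      double : ∀ a → + 2 ℤ.* a ≡ a ℤ.+ a
      double = solve-∀
      2x₀≈0 : + 2 ℤ.* res x₀ ≈ + 0
      2x₀≈0 = ≈-trans (≈-reflexive (double (res x₀)))
                (≈-trans (+-cong (≈-sym -x₀≈x₀) ≈-refl) (≈-reflexive (ℤP.+-inverseˡ (res x₀))))
      2≉0 : ¬ + 2 ≈ + 0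
      2≉0 2≈0 = ℕP.<⇒≱ p>2 (ℕDiv.∣⇒≤ (ℤ∣.∣⇒∣ᵤ (_≈_.p∣a-b 2≈0)))

    root-cases : ∀ {x} → IsRootOf y x ≡ true → x ≡ x₀ ⊎ x ≡ x₁
    root-cases {x} x²≈y = Sum.map (residue-injective ∘ -≈0⇒≈) (λ x+x₀≈0 → residue-injective (x≈x₁ x+x₀≈0))
      (≈0-product p-prime (res x ℤ.- res x₀) (res x ℤ.+ res x₀) factored)
      where
      factor : ∀ a b → a ℤ.* a ℤ.- b ℤ.* b ≡ (a ℤ.- b) ℤ.* (a ℤ.+ b)
      factor = solve-∀
      factored : (res x ℤ.- res x₀) ℤ.* (res x ℤ.+ res x₀) ≈ + 0
      factored = ≈-trans (≈-reflexive (sym (factor (res x) (res x₀))))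
                         (≈⇒-≈0 (≈-trans (congᵇ-sound {res x ℤ.* res x} x²≈y) (≈-sym x₀²≈y)))
      x≈x₁ : res x ℤ.+ res x₀ ≈ + 0 → res x ≈ res x₁
      x≈x₁ x+x₀≈0 =
        ≈-trans (-≈0⇒≈ (≈-trans (≈-reflexive (cong (ℤ._+_ (res x)) (ℤP.neg-involutive (res x₀)))) x+x₀≈0))
                (residue-≈ (ℤ.- res x₀))

    x₁-root : IsRootOf y x₁ ≡ true
    x₁-root = congᵇ-complete
      (≈-trans (*-cong x₁≈-x₀ x₁≈-x₀) (≈-trans (≈-reflexive (neg²≡ (res x₀))) x₀²≈y))
      where
      neg²≡ : ∀ a → ℤ.- a ℤ.* ℤ.- a ≡ a ℤ.* a
      neg²≡ = solve-∀
      x₁≈-x₀ : res x₁ ≈ ℤ.- res x₀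
      x₁≈-x₀ = ≈-sym (residue-≈ (ℤ.- res x₀))

    roots-characterised : ∀ x → IsRootOf y x ≡ does (x FinP.≟ x₀) ∨ does (x FinP.≟ x₁)
    roots-characterised x with x FinP.≟ x₀ | x FinP.≟ x₁
    ... | yes refl | _        = congᵇ-complete x₀²≈y
    ... | no _     | yes refl = x₁-root
    ... | no x≢x₀  | no x≢x₁ with IsRootOf y x in root
    ...   | true  = ⊥-elim ([ x≢x₀ , x≢x₁ ]′ (root-cases root))
    ...   | false = refl

    roots-two : roots y ≡ + 2
    roots-two = begin
      ∑[ x ← allFin p ] ⟦ IsRootOf y x ⟧ + 1
        ≡⟨ ∑-cong (allFin p) (λ x → cong (⟦_⟧ + 1) (roots-characterised x)) ⟩
      ∑[ x ← allFin p ] ⟦ does (x FinP.≟ x₀) ∨ does (x FinP.≟ x₁) ⟧ + 1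
        ≡⟨ ∑-cong (allFin p) (λ x → ⟦⟧-∨ (does (x FinP.≟ x₀)) _ (+ 1) (exclusive x)) ⟩
      ∑[ x ← allFin p ] (⟦ does (x FinP.≟ x₀) ⟧ + 1 ℤ.+ ⟦ does (x FinP.≟ x₁) ⟧ + 1)
        ≡⟨ ∑-+ (allFin p) _ _ ⟩
      ∑ (allFin p) (λ x → ⟦ does (x FinP.≟ x₀) ⟧ + 1) ℤ.+ ∑ (allFin p) (λ x → ⟦ does (x FinP.≟ x₁) ⟧ + 1)
        ≡⟨ cong₂ ℤ._+_ (∑-allFin-δ p x₀ (+ 1)) (∑-allFin-δ p x₁ (+ 1)) ⟩
      + 2 ∎
      where
      open ≡-Reasoning
      exclusive : ∀ x → does (x FinP.≟ x₀) ≡ true → does (x FinP.≟ x₁) ≡ false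
      exclusive x _ with x FinP.≟ x₀ | x FinP.≟ x₁
      ... | yes refl | yes x₀≡x₁ = ⊥-elim (x₁≢x₀ (sym x₀≡x₁))
      ... | yes _    | no _      = refl

  roots+δ₀ : ∀ y → roots y ℤ.+ ⟦ does (y FinP.≟ 0ₚ) ⟧ + 1 ≡ + 2 ℤ.* ⟦ isSquare y ⟧ + 1
  roots+δ₀ y with y FinP.≟ 0ₚ | isSquare y in square
  ... | yes refl | true  rewrite roots-0ₚ = refl
  ... | yes refl | false with () ← trans (sym (any-true⁺ (IsRootOf 0ₚ) (∈-allFin 0ₚ) 0ₚ-root)) square
  ... | no y≢0 | true  = trans (ℤP.+-identityʳ _) (roots-two y x₀ x₀²≈y x₀≢0)
    where
    x₀ = proj₁ (any-true⁻ (IsRootOf y) (allFin p) square)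
    x₀²≈y = congᵇ-sound (proj₂ (any-true⁻ (IsRootOf y) (allFin p) square))
    x₀≢0 : ¬ x₀ ≡ 0ₚ
    x₀≢0 x₀≡0 = y≢0 (sym (residue-injective
      (≈-trans (≈-reflexive (sym 0²≡0)) (subst (λ x → res x ℤ.* res x ≈ res y) x₀≡0 x₀²≈y))))
  ... | no y≢0 | false = trans (ℤP.+-identityʳ _) (roots-nonsquare y square)

  ∑-roots : ∑[ y ← allFin p ] roots y ≡ + p
  ∑-roots = begin
    ∑[ y ← allFin p ] ∑[ x ← allFin p ] ⟦ IsRootOf y x ⟧ + 1
      ≡⟨ ∑-comm (allFin p) (allFin p) _ ⟩
    ∑[ x ← allFin p ] ∑[ y ← allFin p ] ⟦ congᵇ p (res x ℤ.* res x) (res y) ⟧ + 1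
      ≡⟨ ∑-cong (allFin p) (λ x →
           trans (∑-cong (allFin p) (λ y → cong (⟦_⟧ + 1) (congᵇ-sym p (res x ℤ.* res x) (res y))))
                 (∑-residues-δ (res x ℤ.* res x) (+ 1))) ⟩
    ∑[ x ← allFin p ] + 1
      ≡⟨ trans (∑-allFin-const p (+ 1)) (ℤP.*-identityˡ (+ p)) ⟩
    + p ∎
    where open ≡-Reasoning

  twice-#squares : + 2 ℤ.* ∑ (allFin p) (λ y → ⟦ isSquare y ⟧ + 1) ≡ + p ℤ.+ + 1
  twice-#squares = begin
    + 2 ℤ.* ∑ (allFin p) (λ y → ⟦ isSquare y ⟧ + 1)
      ≡⟨ ∑-*ˡ (allFin p) (+ 2) _ ⟨
    ∑[ y ← allFin p ] + 2 ℤ.* ⟦ isSquare y ⟧ + 1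
      ≡⟨ ∑-cong (allFin p) roots+δ₀ ⟨
    ∑[ y ← allFin p ] (roots y ℤ.+ ⟦ does (y FinP.≟ 0ₚ) ⟧ + 1)
      ≡⟨ ∑-+ (allFin p) _ _ ⟩
    ∑ (allFin p) roots ℤ.+ ∑ (allFin p) (λ y → ⟦ does (y FinP.≟ 0ₚ) ⟧ + 1)
      ≡⟨ cong₂ ℤ._+_ ∑-roots (∑-allFin-δ p 0ₚ (+ 1)) ⟩
    + p ℤ.+ + 1 ∎
    where open ≡-Reasoning

-- Solutions of the difference equations

module Solutions (p : ℕ) (p>0 : 0 < p) where

  open ModularArithmetic p p>0

  ∑-solutions-h : ∀ n (y : Vec (Fin p) (suc n)) → ∑[ h ← allVec p n ] ⟦ solves′ y h ⟧ + 1 ≡ + 1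
  ∑-solutions-h zero    (y₁ ∷ [])      = refl
  ∑-solutions-h (suc n) (y₁ ∷ y₂ ∷ ys) = begin
    ∑[ h ← allVec p (suc n) ] ⟦ solves′ (y₁ ∷ y₂ ∷ ys) h ⟧ + 1
      ≡⟨ ∑-allVec-suc p n _ ⟩
    ∑[ h₁ ← allFin p ] ∑[ hs ← allVec p n ] ⟦ first h₁ ∧ solves′ (y₂ ∷ ys) hs ⟧ + 1
      ≡⟨ ∑-cong (allFin p) (λ h₁ → trans (∑-cong (allVec p n) (λ hs → ⟦⟧-∧ (first h₁) _ (+ 1)))
                                         (sym (∑-⟦⟧ (first h₁) (allVec p n) _))) ⟩
    ∑[ h₁ ← allFin p ] ⟦ first h₁ ⟧ ∑ (allVec p n) (λ hs → ⟦ solves′ (y₂ ∷ ys) hs ⟧ + 1)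
      ≡⟨ ∑-cong (allFin p) (λ h₁ → cong (⟦ first h₁ ⟧_) (∑-solutions-h n (y₂ ∷ ys))) ⟩
    ∑[ h₁ ← allFin p ] ⟦ first h₁ ⟧ + 1
      ≡⟨ ∑-cong (allFin p) (λ h₁ → cong (⟦_⟧ + 1) (congᵇ-sym p (res y₁ ℤ.- res y₂) (res h₁))) ⟩
    ∑[ h₁ ← allFin p ] ⟦ congᵇ p (res h₁) (res y₁ ℤ.- res y₂) ⟧ + 1
      ≡⟨ ∑-residues-δ (res y₁ ℤ.- res y₂) (+ 1) ⟩
    + 1 ∎
    where
    open ≡-Reasoning
    first : Fin p → Bool
    first h₁ = congᵇ p (res y₁ ℤ.- res y₂) (res h₁)

  ∑-solutions-y : ∀ n (h : Vec (Fin p) n) → ∑[ y ← allVec p (suc n) ] ⟦ solves′ y h ⟧ + 1 ≡ + p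
  ∑-solutions-y zero    []       =
    trans (∑-allVec-suc p 0 _) (trans (∑-allFin-const p (+ 1)) (ℤP.*-identityˡ (+ p)))
  ∑-solutions-y (suc n) (h₁ ∷ hs) = begin
    ∑[ y ← allVec p (suc (suc n)) ] ⟦ solves′ y (h₁ ∷ hs) ⟧ + 1
      ≡⟨ ∑-allVec-suc p (suc n) _ ⟩
    ∑[ y₁ ← allFin p ] ∑[ y ← allVec p (suc n) ] ⟦ solves′ (y₁ ∷ y) (h₁ ∷ hs) ⟧ + 1
      ≡⟨ ∑-cong (allFin p) (λ y₁ → ∑-cong (allVec p (suc n)) (λ y → reorder y₁ y)) ⟩
    ∑[ y₁ ← allFin p ] ∑[ y ← allVec p (suc n) ] ⟦ solves′ y hs ⟧ ⟦ first y₁ y ⟧ + 1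
      ≡⟨ ∑-comm (allFin p) (allVec p (suc n)) _ ⟩
    ∑[ y ← allVec p (suc n) ] ∑[ y₁ ← allFin p ] ⟦ solves′ y hs ⟧ ⟦ first y₁ y ⟧ + 1
      ≡⟨ ∑-cong (allVec p (suc n)) (λ y → trans (sym (∑-⟦⟧ (solves′ y hs) (allFin p) _))
                                                (cong (⟦ solves′ y hs ⟧_) (∑-residues-δ (res (Vec.head y) ℤ.+ res h₁) (+ 1)))) ⟩
    ∑[ y ← allVec p (suc n) ] ⟦ solves′ y hs ⟧ + 1
      ≡⟨ ∑-solutions-y n hs ⟩
    + p ∎
    where
    open ≡-Reasoning
    first : Fin p → Vec (Fin p) (suc n) → Bool
    first y₁ y = congᵇ p (res y₁) (res (Vec.head y) ℤ.+ res h₁)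
    shift : ∀ a b c → congᵇ p (a ℤ.- b) c ≡ congᵇ p a (b ℤ.+ c)
    shift a b c = cong (λ z → ⌊ p ℕDiv.∣? ∣ z ∣ ⌋) (regroup a b c)
      where
      regroup : ∀ a b c → (a ℤ.- b) ℤ.- c ≡ a ℤ.- (b ℤ.+ c)
      regroup = solve-∀
    reorder : ∀ y₁ y → ⟦ solves′ (y₁ ∷ y) (h₁ ∷ hs) ⟧ + 1 ≡ ⟦ solves′ y hs ⟧ ⟦ first y₁ y ⟧ + 1
    reorder y₁ (y₂ ∷ ys) rewrite shift (res y₁) (res y₂) (res h₁) =
      trans (⟦⟧-∧ (first y₁ (y₂ ∷ ys)) _ (+ 1)) (⟦⟧-comm (first y₁ (y₂ ∷ ys)) _ (+ 1))

  ShiftOf : ∀ {n} → Vec (Fin p) n → Vec ℤ n → ℤ → Set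
  ShiftOf y c z = ∀ i {a b} → toList y ‼ i ≡ just a → toList c ‼ i ≡ just b → res a ≈ b ℤ.+ z

  solution-shift : ∀ n (y : Vec (Fin p) (suc n)) h → solves′ y h ≡ true → ∃ (ShiftOf y (canon h))
  solution-shift zero (y₁ ∷ []) [] _ = res y₁ , shift
    where
    shift : ShiftOf (y₁ ∷ []) (canon {p} []) (res y₁)
    shift zero refl refl = ≈-reflexive (sym (ℤP.+-identityˡ (res y₁)))
  solution-shift (suc n) (y₁ ∷ y₂ ∷ ys) (h₁ ∷ hs) solves =
    let y₁-y₂≈h₁ , solves-rest = ∧-elim {congᵇ p (res y₁ ℤ.- res y₂) (res h₁)} solves
        z , shift = solution-shift n (y₂ ∷ ys) hs solves-rest
        c₂ = Vec.head (canon hs)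
        y₂≈c₂+z = shift 0 refl (head-canon hs)
        y₁≈h₁+y₂ : res y₁ ≈ res h₁ ℤ.+ res y₂
        y₁≈h₁+y₂ = ≈-trans (≈-reflexive (sym (minus-plus (res y₁) (res y₂))))
                           (+-cong (congᵇ-sound {res y₁ ℤ.- res y₂} {res h₁} y₁-y₂≈h₁) (≈-refl {res y₂}))
        y₁≈c₁+z : res y₁ ≈ (res h₁ ℤ.+ c₂) ℤ.+ z
        y₁≈c₁+z = ≈-trans y₁≈h₁+y₂
          (≈-trans (+-cong (≈-refl {res h₁}) y₂≈c₂+z) (≈-reflexive (sym (ℤP.+-assoc (res h₁) c₂ z))))
    in  z , λ { zero refl refl → y₁≈c₁+z ; (suc i) → shift i }
    where
    minus-plus : ∀ a b → (a ℤ.- b) ℤ.+ b ≡ a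
    minus-plus = solve-∀
    head-canon : ∀ {n} (h : Vec (Fin p) n) → toList (canon h) ‼ 0 ≡ just (Vec.head (canon h))
    head-canon []      = refl
    head-canon (_ ∷ _) = refl

  distinct-solution : ∀ n (y : Vec (Fin p) (suc n)) h → solves′ y h ≡ true →
                      distinctℕ (map toℕ (toList y)) ≡ distinctMod p (toList (canon h))
  distinct-solution n y h solves = begin
    distinctℕ (map toℕ (toList y))          ≡⟨ distinctℕ-by (map toℕ (toList y)) ⟩
    distinctBy ℕ._≡ᵇ_ (map toℕ (toList y))
      ≡⟨ distinctBy-pattern ℕ._≡ᵇ_ (congᵇ p) (map toℕ (toList y)) (toList (canon h)) same-length same-pattern ⟩
    distinctBy (congᵇ p) (toList (canon h)) ≡⟨ distinctMod-by p (toList (canon h)) ⟨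
    distinctMod p (toList (canon h))        ∎
    where
    open ≡-Reasoning
    z = proj₁ (solution-shift n y h solves)
    shift = proj₂ (solution-shift n y h solves)
    same-length = trans (ListP.length-map toℕ (toList y)) (trans (VecP.length-toList y) (sym (VecP.length-toList (canon h))))
    entry : ∀ i {a} → map toℕ (toList y) ‼ i ≡ just a → ∃ λ yᵢ → toList y ‼ i ≡ just yᵢ × a ≡ toℕ yᵢ
    entry i eq with toList y ‼ i in y‼i | trans (sym (‼-map toℕ (toList y) i)) eq
    ... | just yᵢ | refl = yᵢ , refl , refl
    same-pattern : SamePattern ℕ._≡ᵇ_ (congᵇ p) (map toℕ (toList y)) (toList (canon h))
    same-pattern i j {b = b} {b′} y‼i y‼j c‼i c‼j with entry i y‼i | entry j y‼j
    ... | yᵢ , yᵢ∈ , refl | yⱼ , yⱼ∈ , refl = Bool-ext to from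
      where
      yᵢ≈ = shift i yᵢ∈ c‼i
      yⱼ≈ = shift j yⱼ∈ c‼j
      to : (toℕ yᵢ ℕ.≡ᵇ toℕ yⱼ) ≡ true → congᵇ p b b′ ≡ true
      to yᵢ≡ᵇyⱼ = congᵇ-complete {b} {b′}
        (+-cancelʳ z (≈-trans (≈-sym yᵢ≈) (subst (λ w → res w ≈ b′ ℤ.+ z) (sym yᵢ≡yⱼ) yⱼ≈)))
        where
        yᵢ≡yⱼ = FinP.toℕ-injective {i = yᵢ} {j = yⱼ} (≡ᵇ⇒≡ yᵢ≡ᵇyⱼ)
      from : congᵇ p b b′ ≡ true → (toℕ yᵢ ℕ.≡ᵇ toℕ yⱼ) ≡ true
      from b≈b′
        rewrite residue-injective (≈-trans yᵢ≈ (≈-trans (+-cong (congᵇ-sound {b} {b′} b≈b′) ≈-refl) (≈-sym yⱼ≈)))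
        = ≡ᵇ-refl (toℕ yⱼ)

module LeftSide (p : ℕ) (p>0 : 0 < p) where

  open Solutions p p>0

  reff≤r : ∀ n h → reff p (suc n) h ≤ suc n
  reff≤r n h = subst₂ _≤_ (sym (distinctMod-by p (toList (canon h)))) (VecP.length-toList (canon h))
                          (distinctBy-≤ (congᵇ p) (toList (canon h)))

  aΔ-expand : ∀ n h → a p (suc n) h ℤ.* + Δ p (suc n) h ≡
                + (2 ^ suc n) ℤ.* + N p (suc n) h ℤ.- + p ℤ.* + (2 ^ (suc n ∸ reff p (suc n) h))
  aΔ-expand n h = trans (distrib (+ (2 ^ e ℕ.* N p (suc n) h)) (+ p) (+ (2 ^ (suc n ∸ e))))
                  (cong (ℤ._- + p ℤ.* + (2 ^ (suc n ∸ e)))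
                        (trans (sym (ℤP.pos-* (2 ^ e ℕ.* N p (suc n) h) _)) (trans (cong +_ powers) (ℤP.pos-* (2 ^ suc n) _))))
    where
    e = reff p (suc n) h
    distrib : ∀ x y z → (x ℤ.- y) ℤ.* z ≡ x ℤ.* z ℤ.- y ℤ.* z
    distrib = solve-∀
    powers : 2 ^ e ℕ.* N p (suc n) h ℕ.* 2 ^ (suc n ∸ e) ≡ 2 ^ suc n ℕ.* N p (suc n) h
    powers = begin
      2 ^ e ℕ.* N p (suc n) h ℕ.* 2 ^ (suc n ∸ e)   ≡⟨ ℕP.*-assoc (2 ^ e) _ _ ⟩
      2 ^ e ℕ.* (N p (suc n) h ℕ.* 2 ^ (suc n ∸ e)) ≡⟨ cong (2 ^ e ℕ.*_) (ℕP.*-comm (N p (suc n) h) _) ⟩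
      2 ^ e ℕ.* (2 ^ (suc n ∸ e) ℕ.* N p (suc n) h) ≡⟨ ℕP.*-assoc (2 ^ e) _ _ ⟨
      2 ^ e ℕ.* 2 ^ (suc n ∸ e) ℕ.* N p (suc n) h   ≡⟨ cong (ℕ._* N p (suc n) h) (ℕP.^-distribˡ-+-* 2 e (suc n ∸ e)) ⟨
      2 ^ (e ℕ.+ (suc n ∸ e)) ℕ.* N p (suc n) h     ≡⟨ cong (λ k → 2 ^ k ℕ.* N p (suc n) h) (ℕP.m+[n∸m]≡n (reff≤r n h)) ⟩
      2 ^ suc n ℕ.* N p (suc n) h                   ∎
      where open ≡-Reasoning

  ∑-N : ∀ n → ∑[ h ← allVec p n ] + N p (suc n) h ≡ ∑[ y ← allVec p (suc n) ] ⟦ allSquares y ⟧ + 1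
  ∑-N n = begin
    ∑[ h ← allVec p n ] + N p (suc n) h
      ≡⟨ ∑-cong (allVec p n) (λ h → length-filter (allVec p (suc n)) (λ y → allSquares y ∧ solves′ y h)) ⟩
    ∑[ h ← allVec p n ] ∑[ y ← allVec p (suc n) ] ⟦ allSquares y ∧ solves′ y h ⟧ + 1
      ≡⟨ ∑-comm (allVec p n) (allVec p (suc n)) _ ⟩
    ∑[ y ← allVec p (suc n) ] ∑[ h ← allVec p n ] ⟦ allSquares y ∧ solves′ y h ⟧ + 1
      ≡⟨ ∑-cong (allVec p (suc n)) (λ y → trans (∑-cong (allVec p n) (λ h → ⟦⟧-∧ (allSquares y) _ _))
           (trans (sym (∑-⟦⟧ (allSquares y) (allVec p n) _)) (cong (⟦ allSquares y ⟧_) (∑-solutions-h n y)))) ⟩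
    ∑[ y ← allVec p (suc n) ] ⟦ allSquares y ⟧ + 1 ∎
    where open ≡-Reasoning

  ∑-reff-weights : ∀ n → ∑[ h ← allVec p n ] + p ℤ.* + (2 ^ (suc n ∸ reff p (suc n) h)) ≡ ∑2^codim p (suc n)
  ∑-reff-weights n = sym (begin
    ∑[ y ← allVec p (suc n) ] w y
      ≡⟨ ∑-cong (allVec p (suc n)) (λ y → trans (sym (ℤP.*-identityʳ (w y)))
           (trans (cong (w y ℤ.*_) (sym (∑-solutions-h n y))) (sym (∑-*ˡ (allVec p n) (w y) _)))) ⟩
    ∑[ y ← allVec p (suc n) ] ∑[ h ← allVec p n ] w y ℤ.* ⟦ solves′ y h ⟧ + 1
      ≡⟨ ∑-comm (allVec p (suc n)) (allVec p n) _ ⟩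
    ∑[ h ← allVec p n ] ∑[ y ← allVec p (suc n) ] w y ℤ.* ⟦ solves′ y h ⟧ + 1
      ≡⟨ ∑-cong (allVec p n) (λ h → ∑-cong (allVec p (suc n)) (weight-of-solution h)) ⟩
    ∑[ h ← allVec p n ] ∑[ y ← allVec p (suc n) ] 2^codim h ℤ.* ⟦ solves′ y h ⟧ + 1
      ≡⟨ ∑-cong (allVec p n) (λ h → trans (∑-*ˡ (allVec p (suc n)) (2^codim h) _)
           (trans (cong (2^codim h ℤ.*_) (∑-solutions-y n h)) (ℤP.*-comm (2^codim h) (+ p)))) ⟩
    ∑[ h ← allVec p n ] + p ℤ.* 2^codim h ∎)
    where
    open ≡-Reasoning
    w : Vec (Fin p) (suc n) → ℤ
    w y = + (2 ^ (suc n ∸ numBlocks (Vec.map toℕ y)))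
    2^codim : Vec (Fin p) n → ℤ
    2^codim h = + (2 ^ (suc n ∸ reff p (suc n) h))
    weight-of-solution : ∀ h y → w y ℤ.* ⟦ solves′ y h ⟧ + 1 ≡ 2^codim h ℤ.* ⟦ solves′ y h ⟧ + 1
    weight-of-solution h y with solves′ y h in solves
    ... | false = trans (ℤP.*-zeroʳ (w y)) (sym (ℤP.*-zeroʳ (2^codim h)))
    ... | true  = cong (λ k → + (2 ^ (suc n ∸ k)) ℤ.* + 1)
                    (trans (cong distinctℕ (VecP.toList-map toℕ y)) (distinct-solution n y h solves))

  module _ (p-prime : Prime p) (p>2 : 2 < p) where

    open Squares p p>0 p-prime p>2

    2^k*#squareTuples : ∀ k → + (2 ^ k) ℤ.* ∑ (allVec p k) (λ y → ⟦ allSquares y ⟧ + 1) ≡ + ((p ℕ.+ 1) ^ k)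
    2^k*#squareTuples zero    = refl
    2^k*#squareTuples (suc k) = begin
      + (2 ^ suc k) ℤ.* ∑ (allVec p (suc k)) (λ y → ⟦ allSquares y ⟧ + 1)
        ≡⟨ cong (+ (2 ^ suc k) ℤ.*_) split ⟩
      + (2 ^ suc k) ℤ.* (squares ℤ.* tuples)
        ≡⟨ cong (ℤ._* (squares ℤ.* tuples)) (ℤP.pos-* 2 (2 ^ k)) ⟩
      (+ 2 ℤ.* + (2 ^ k)) ℤ.* (squares ℤ.* tuples)
        ≡⟨ regroup (+ 2) (+ (2 ^ k)) squares tuples ⟩
      (+ 2 ℤ.* squares) ℤ.* (+ (2 ^ k) ℤ.* tuples)
        ≡⟨ cong₂ ℤ._*_ twice-#squares (2^k*#squareTuples k) ⟩
      (+ p ℤ.+ + 1) ℤ.* + ((p ℕ.+ 1) ^ k)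
        ≡⟨ ℤP.pos-* (p ℕ.+ 1) _ ⟨
      + ((p ℕ.+ 1) ^ suc k) ∎
      where
      open ≡-Reasoning
      squares = ∑ (allFin p) (λ x → ⟦ isSquare x ⟧ + 1)
      tuples  = ∑ (allVec p k) (λ y → ⟦ allSquares y ⟧ + 1)
      regroup : ∀ a b c d → (a ℤ.* b) ℤ.* (c ℤ.* d) ≡ (a ℤ.* c) ℤ.* (b ℤ.* d)
      regroup = solve-∀
      split : ∑ (allVec p (suc k)) (λ y → ⟦ allSquares y ⟧ + 1) ≡ squares ℤ.* tuples
      split = begin
        ∑ (allVec p (suc k)) (λ y → ⟦ allSquares y ⟧ + 1)
          ≡⟨ ∑-allVec-suc p k _ ⟩
        ∑[ x ← allFin p ] ∑[ y ← allVec p k ] ⟦ isSquare x ∧ allSquares y ⟧ + 1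
          ≡⟨ ∑-cong (allFin p) (λ x → trans (∑-cong (allVec p k) (λ y → ⟦⟧-∧ (isSquare x) _ _))
                                            (sym (∑-⟦⟧ (isSquare x) (allVec p k) _))) ⟩
        ∑[ x ← allFin p ] ⟦ isSquare x ⟧ tuples
          ≡⟨ ∑-cong (allFin p) (λ x → sym (⟦⟧-*-one (isSquare x) tuples)) ⟩
        ∑[ x ← allFin p ] tuples ℤ.* ⟦ isSquare x ⟧ + 1
          ≡⟨ ∑-*ˡ (allFin p) tuples _ ⟩
        tuples ℤ.* squares
          ≡⟨ ℤP.*-comm tuples squares ⟩
        squares ℤ.* tuples ∎

    lhs-formula : ∀ n → lhs p (suc n) ≡ + ((p ℕ.+ 1) ^ suc n) ℤ.- ∑2^codim p (suc n)
    lhs-formula n = begin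
      lhs p (suc n)
        ≡⟨ ∑-cong (allVec p n) (aΔ-expand n) ⟩
      ∑[ h ← allVec p n ] (+ (2 ^ suc n) ℤ.* + N p (suc n) h ℤ.- + p ℤ.* + (2 ^ (suc n ∸ reff p (suc n) h)))
        ≡⟨ ∑-minus (allVec p n) _ _ ⟩
      ∑ (allVec p n) (λ h → + (2 ^ suc n) ℤ.* + N p (suc n) h) ℤ.-
      ∑ (allVec p n) (λ h → + p ℤ.* + (2 ^ (suc n ∸ reff p (suc n) h)))
        ≡⟨ cong₂ ℤ._-_ (trans (∑-*ˡ (allVec p n) (+ (2 ^ suc n)) (λ h → + N p (suc n) h))
                              (trans (cong (+ (2 ^ suc n) ℤ.*_) (∑-N n)) (2^k*#squareTuples (suc n))))
                       (∑-reff-weights n) ⟩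
      + ((p ℕ.+ 1) ^ suc n) ℤ.- ∑2^codim p (suc n) ∎
      where open ≡-Reasoning

ℤ→ℚ-toℚᵘ : ∀ z → ℚ.toℚᵘ (ℤ→ℚ z) ℚᵘ.≃ ℚᵘ.mkℚᵘ z 0
ℤ→ℚ-toℚᵘ z = ℚP.toℚᵘ-fromℚᵘ (ℚᵘ.mkℚᵘ z 0)

ℤ→ℚ-+ : ∀ a b → ℤ→ℚ (a ℤ.+ b) ≡ ℤ→ℚ a ℚ.+ ℤ→ℚ b
ℤ→ℚ-+ a b = ℚP.toℚᵘ-injective (ℚᵘP.≃-trans (ℤ→ℚ-toℚᵘ (a ℤ.+ b)) (ℚᵘP.≃-trans (ℚᵘ.*≡* (over-1 a b))
  (ℚᵘP.≃-sym (ℚᵘP.≃-trans (ℚP.toℚᵘ-homo-+ (ℤ→ℚ a) (ℤ→ℚ b)) (ℚᵘP.+-cong (ℤ→ℚ-toℚᵘ a) (ℤ→ℚ-toℚᵘ b))))))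
  where
  over-1 : ∀ a b → (a ℤ.+ b) ℤ.* + 1 ≡ (a ℤ.* + 1 ℤ.+ b ℤ.* + 1) ℤ.* + 1
  over-1 = solve-∀

ℤ→ℚ-* : ∀ a b → ℤ→ℚ (a ℤ.* b) ≡ ℤ→ℚ a ℚ.* ℤ→ℚ b
ℤ→ℚ-* a b = ℚP.toℚᵘ-injective (ℚᵘP.≃-trans (ℤ→ℚ-toℚᵘ (a ℤ.* b)) (ℚᵘP.≃-trans (ℚᵘ.*≡* refl)
  (ℚᵘP.≃-sym (ℚᵘP.≃-trans (ℚP.toℚᵘ-homo-* (ℤ→ℚ a) (ℤ→ℚ b)) (ℚᵘP.*-cong (ℤ→ℚ-toℚᵘ a) (ℤ→ℚ-toℚᵘ b))))))

ℤ→ℚ-neg : ∀ a → ℤ→ℚ (ℤ.- a) ≡ ℚ.- ℤ→ℚ a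
ℤ→ℚ-neg a = ℚP.toℚᵘ-injective (ℚᵘP.≃-trans (ℤ→ℚ-toℚᵘ (ℤ.- a))
  (ℚᵘP.≃-sym (ℚᵘP.≃-trans (ℚP.toℚᵘ-homo‿- (ℤ→ℚ a)) (ℚᵘP.-‿cong (ℤ→ℚ-toℚᵘ a)))))

ℤ→ℚ-minus : ∀ a b → ℤ→ℚ (a ℤ.- b) ≡ ℤ→ℚ a ℚ.- ℤ→ℚ b
ℤ→ℚ-minus a b = trans (ℤ→ℚ-+ a (ℤ.- b)) (cong (ℤ→ℚ a ℚ.+_) (ℤ→ℚ-neg b))

ℤ→ℚ-∑ : {A : Set} (xs : List A) (f : A → ℤ) → ℤ→ℚ (∑ xs f) ≡ sumℚ (map (ℤ→ℚ ∘ f) xs)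
ℤ→ℚ-∑ []       f = refl
ℤ→ℚ-∑ (x ∷ xs) f = trans (ℤ→ℚ-+ (f x) (∑ xs f)) (cong (ℤ→ℚ (f x) ℚ.+_) (ℤ→ℚ-∑ xs f))

*-sumℚ : {A : Set} (c : ℚ) (xs : List A) (g : A → ℚ) → c ℚ.* sumℚ (map g xs) ≡ sumℚ (map (λ x → c ℚ.* g x) xs)
*-sumℚ c []       g = ℚP.*-zeroʳ c
*-sumℚ c (x ∷ xs) g = trans (ℚP.*-distribˡ-+ c (g x) _) (cong (c ℚ.* g x ℚ.+_) (*-sumℚ c xs g))

sumℚ-cong : {A : Set} (xs : List A) {f g : A → ℚ} → (∀ x → f x ≡ g x) → sumℚ (map f xs) ≡ sumℚ (map g xs)
sumℚ-cong []       f≗g = refl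
sumℚ-cong (x ∷ xs) f≗g = cong₂ ℚ._+_ (f≗g x) (sumℚ-cong xs f≗g)

n*1/n : ∀ n .{{_ : ℕ.NonZero n}} → ℤ→ℚ (+ n) ℚ.* (+ 1 ℚ./ n) ≡ ℚ.1ℚ
n*1/n (suc m) = ℚP.toℚᵘ-injective
  (ℚᵘP.≃-trans (ℚP.toℚᵘ-homo-* (ℤ→ℚ (+ suc m)) (ℚ.fromℚᵘ (ℚᵘ.mkℚᵘ (+ 1) m)))
  (ℚᵘP.≃-trans (ℚᵘP.*-cong (ℤ→ℚ-toℚᵘ (+ suc m)) (ℚP.toℚᵘ-fromℚᵘ (ℚᵘ.mkℚᵘ (+ 1) m)))
  (ℚᵘP.≃-trans (ℚᵘ.*≡* (cong (λ k → + suc k) (arith m))) (ℚᵘP.≃-sym (ℤ→ℚ-toℚᵘ (+ 1))))))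
  where
  arith : ∀ m → m ℕ.* 1 ℕ.* 1 ≡ m ℕ.+ 0 ℕ.+ 0
  arith = ℕSolver.solve-∀

numBlocks≤r : ∀ {r} (G : SetPartition r) → numBlocks G ≤ r
numBlocks≤r G = subst₂ _≤_ (sym (distinctℕ-by (toList G))) (VecP.length-toList G) (distinctBy-≤ ℕ._≡ᵇ_ (toList G))

p^r*p^-codim : ∀ q z {k r} → k ≤ r →
               ℤ→ℚ (+ (suc q ^ r)) ℚ.* (ℤ→ℚ z ℚ.* invPow (suc q) (r ∸ k)) ≡ ℤ→ℚ (z ℤ.* + (suc q ^ k))
p^r*p^-codim q z {k} {r} k≤r = begin
  ℤ→ℚ (+ (p ^ r)) ℚ.* (Z ℚ.* invPow p (r ∸ k))
    ≡⟨ cong (ℚ._* (Z ℚ.* invPow p (r ∸ k))) (trans (cong ℤ→ℚ p^r≡) (ℤ→ℚ-* (+ (p ^ k)) (+ (p ^ (r ∸ k))))) ⟩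
  (ℤ→ℚ (+ (p ^ k)) ℚ.* ℤ→ℚ (+ (p ^ (r ∸ k)))) ℚ.* (Z ℚ.* invPow p (r ∸ k))
    ≡⟨ interchange (ℤ→ℚ (+ (p ^ k))) _ Z _ ⟩
  (ℤ→ℚ (+ (p ^ k)) ℚ.* Z) ℚ.* (ℤ→ℚ (+ (p ^ (r ∸ k))) ℚ.* invPow p (r ∸ k))
    ≡⟨ cong₂ ℚ._*_ (trans (ℚP.*-comm _ Z) (sym (ℤ→ℚ-* z (+ (p ^ k)))))
                   (n*1/n (p ^ (r ∸ k)) {{ℕP.m^n≢0 p (r ∸ k)}}) ⟩
  ℤ→ℚ (z ℤ.* + (p ^ k)) ℚ.* ℚ.1ℚ
    ≡⟨ ℚP.*-identityʳ _ ⟩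
  ℤ→ℚ (z ℤ.* + (p ^ k)) ∎
  where
  open ≡-Reasoning
  p = suc q
  Z = ℤ→ℚ z
  p^r≡ : + (p ^ r) ≡ + (p ^ k) ℤ.* + (p ^ (r ∸ k))
  p^r≡ = trans (cong (λ e → + (p ^ e)) (sym (ℕP.m+[n∸m]≡n k≤r)))
               (trans (cong +_ (ℕP.^-distribˡ-+-* p k (r ∸ k))) (ℤP.pos-* (p ^ k) (p ^ (r ∸ k))))

ℤ→ℚ-∑λP*p^blocks : ∀ q r →
  ℤ→ℚ (∑[ G ← setPartitions r ] λP r G ℤ.* + (suc q ^ numBlocks G)) ≡
  ℤ→ℚ (+ (suc q ^ r)) ℚ.* sumℚ (map (λ G → ℤ→ℚ (λP r G) ℚ.* invPow (suc q) (codimH G)) (setPartitions r))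
ℤ→ℚ-∑λP*p^blocks q r = begin
  ℤ→ℚ (∑[ G ← setPartitions r ] λP r G ℤ.* + (suc q ^ numBlocks G))
    ≡⟨ ℤ→ℚ-∑ (setPartitions r) (λ G → λP r G ℤ.* + (suc q ^ numBlocks G)) ⟩
  sumℚ (map (λ G → ℤ→ℚ (λP r G ℤ.* + (suc q ^ numBlocks G))) (setPartitions r))
    ≡⟨ sumℚ-cong (setPartitions r) (λ G → p^r*p^-codim q (λP r G) (numBlocks≤r G)) ⟨
  sumℚ (map (λ G → ℤ→ℚ (+ (suc q ^ r)) ℚ.* (ℤ→ℚ (λP r G) ℚ.* invPow (suc q) (codimH G))) (setPartitions r))
    ≡⟨ *-sumℚ (ℤ→ℚ (+ (suc q ^ r))) (setPartitions r) _ ⟨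
  ℤ→ℚ (+ (suc q ^ r)) ℚ.* sumℚ (map (λ G → ℤ→ℚ (λP r G) ℚ.* invPow (suc q) (codimH G)) (setPartitions r)) ∎
  where open ≡-Reasoning

lemma4p2 : (p : ℕ) → Prime p → 2 < p → (r : ℕ) → 2 ≤ r →
    ℤ→ℚ (lhs p r) ≡ rhs p r
lemma4p2 (suc q) p-prime p>2 (suc n) _ = begin
  ℤ→ℚ (lhs p r)
    ≡⟨ cong ℤ→ℚ (LeftSide.lhs-formula p (s≤s z≤n) p-prime p>2 n) ⟩
  ℤ→ℚ (+ ((p ℕ.+ 1) ^ r) ℤ.- ∑2^codim p r)
    ≡⟨ cong (λ s → ℤ→ℚ (+ ((p ℕ.+ 1) ^ r) ℤ.- s)) (Partitions.∑-λP-weighted r p) ⟨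
  ℤ→ℚ (+ ((p ℕ.+ 1) ^ r) ℤ.- Λ)
    ≡⟨ ℤ→ℚ-minus (+ ((p ℕ.+ 1) ^ r)) Λ ⟩
  ℤ→ℚ (+ ((p ℕ.+ 1) ^ r)) ℚ.- ℤ→ℚ Λ
    ≡⟨ cong (ℚ._-_ (ℤ→ℚ (+ ((p ℕ.+ 1) ^ r)))) (ℤ→ℚ-∑λP*p^blocks q r) ⟩
  rhs p r ∎
  where
  open ≡-Reasoning
  p = suc q
  r = suc n
  Λ = ∑[ G ← setPartitions r ] λP r G ℤ.* + (p ^ numBlocks G)
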